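{- Let $k\ge 2$ be an integer. For every integer $n\ge1$, \[ k\sum_{i=1}^{n}\big(\sigma(i)+\sigma_o(i)\big)(-1)^{n-i}r_k(n-i)=(-1)^{n+1}n\,r_k(n). \]
   Context: $r_k(m)$ is the number of representations of $m$ as an ordered sum of $k$ squares of integers (signs and order counted), with $r_k(0)=1$. $\sigma(i)$ is the sum of positive divisors of $i$ and $\sigma_o(i)$ the sum of odd positive divisors of $i$. -}

module Defs where

open import Data.Nat as ℕ using (ℕ; zero; suc)
open import Data.Integer as ℤ using (ℤ; +_; -_)
open import Data.List using (List; []; _∷_; map; concatMap; length; _++_; filter; upTo)
open import Data.Nat.ListAction using (sum)
open import Data.Vec using (Vec; []; _∷_; foldr)
open import Data.Nat.Divisibility using (_∣?_)
open import Data.Integer using () renaming (_≟_ to _≟ℤ_)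
open import Relation.Nullary using (Dec; yes; no; ¬?)

range : ℕ → List ℤ
range m = map (λ i → + i) (upTo (suc m)) ++ map (λ i → - (+ suc i)) (upTo m)

boxVecs : (k : ℕ) → ℕ → List (Vec ℤ k)
boxVecs zero    m = [] ∷ []
boxVecs (suc k) m = concatMap (λ x → map (x ∷_) (boxVecs k m)) (range m)

sumSq : ∀ {k} → Vec ℤ k → ℤ
sumSq = foldr _ (λ x acc → x ℤ.* x ℤ.+ acc) (+ 0)

-- r k m : number of (x₁,…,x_k) ∈ ℤ^k with x₁²+…+x_k² = m
-- (every such vector has |xᵢ| ≤ m, so enumerating [-m,m]^k is exhaustive);
-- r k 0 = 1 (the zero vector; for k = 0 the empty vector).
r : ℕ → ℕ → ℕ
r k m = length (filter (λ v → sumSq v ≟ℤ + m) (boxVecs k m))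

divisors : ℕ → List ℕ
divisors n = filter (λ d → d ∣? n) (map suc (upTo n))

σ : ℕ → ℕ
σ n = sum (divisors n)

σₒ : ℕ → ℕ
σₒ n = sum (filter (λ d → ¬? (2 ∣? d)) (divisors n))

Σ[1…_]_ : ℕ → (ℕ → ℤ) → ℤ
Σ[1… zero  ] f = + 0
Σ[1… suc n ] f = Σ[1… n ] f ℤ.+ f (suc n)

sgn : ℕ → ℤ
sgn zero    = + 1
sgn (suc n) = - sgn n

{-# OPTIONS --safe #-}
-- Write θ(q) = Σ_{j ∈ ℤ} q^(j²), so that θ(q)ᵏ = Σ_m r_k(m) qᵐ.  By Jacobi's triple product
-- θ(-q) = Π_{i ≥ 1} (1 - q^(2i)) (1 - q^(2i-1))², and since -q d/dq log (1 - qᵃ) = Σ_{a ∣ m} a qᵐ,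
-- the Euler operator D = q d/dq satisfies D θ(-q)ᵏ = -k θ(-q)ᵏ Σ_{m ≥ 1} (σ(m) + σₒ(m)) qᵐ: every
-- divisor is counted once by the factors 1 - q^(2i) and 1 - q^(2i-1) together, and the odd ones
-- once more by the second factor 1 - q^(2i-1).  Comparing coefficients of qⁿ gives the identity.
-- All of this is done with formal power series ℕ → ℤ, and the triple product is only needed
-- modulo q^(2n+1), where it follows from the finite q-binomial theorem.

module Submission where

open import Defs
open import Data.Nat using (ℕ; _≥_; _∸_)
open import Data.Integer using (ℤ; +_; _*_; _+_)
open import Relation.Binary.PropositionalEquality using (_≡_)

open import Algebra.Bundles using (CommutativeRing; CommutativeMonoid)
open import Algebra.Solver.Ring.AlmostCommutativeRing using (fromCommutativeRing; _-Raw-AlmostCommutative⟶_)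
open import Algebra.Structures using (IsCommutativeRing)
open import Data.Bool using (true; false; if_then_else_)
open import Data.Integer as ℤ using (-_)
import Data.Integer.Properties as ℤₚ
open import Data.Integer.Tactic.RingSolver using (solve-∀)
open import Data.List using (List; []; _∷_; _++_; map; concatMap; filter; length; upTo; applyUpTo)
import Data.List.Properties as List
import Data.List.Relation.Unary.All as All
open import Data.Maybe using (Maybe; just; nothing)
open import Data.Nat as ℕ using (zero; suc; pred; _≤_; _<_; z≤n; s≤s; ∣_-_∣)
open import Data.Nat.Divisibility using (_∣_; _∣?_; divides; ∣⇒≤; ∣-refl; ∣m∣n⇒∣m+n; ∣m+n∣m⇒∣n)
open import Data.Nat.ListAction using (sum)
import Data.Nat.Properties as ℕₚ
import Data.Nat.Tactic.RingSolver as ℕ-Solver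
open import Data.Product using (_×_; _,_)
open import Data.Sum as Sum using (_⊎_; inj₁; inj₂)
open import Data.Vec using (Vec; []; _∷_)
open import Function using (_∘_; _⟨_⟩_)
open import Function.Bundles using (mk⇔)
open import Level using (0ℓ)
open import Relation.Binary.Bundles using (Setoid)
open import Relation.Binary.PropositionalEquality
  using (_≗_; _≢_; refl; sym; trans; cong; cong₂; subst; _→-setoid_; module ≡-Reasoning)
import Relation.Binary.Reasoning.Setoid
open import Relation.Nullary using (Dec; ¬_; ¬?; yes; no)
open import Relation.Nullary.Decidable using (does; dec-true; dec-false; does-⇔)
open import Relation.Unary using (Pred; Decidable; _≐_)

-- Formal power series over ℤ

Series : Set
Series = ℕ → ℤ

infixl 6 _+ˢ_
infixl 7 _*ˢ_ _·_
infix 8 -ˢ_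

_+ˢ_ : Series → Series → Series
(f +ˢ g) n = f n + g n

-ˢ_ : Series → Series
(-ˢ f) n = - f n

_·_ : ℤ → Series → Series
(c · f) n = c * f n

const : ℤ → Series
const c zero    = c
const c (suc n) = + 0

𝟘 𝟙 : Series
𝟘 _ = + 0
𝟙 = const (+ 1)

tail : Series → Series
tail f n = f (suc n)

_*ˢ_ : Series → Series → Series
(f *ˢ g) zero    = f 0 * g 0
(f *ˢ g) (suc n) = f 0 * g (suc n) + (tail f *ˢ g) n

*ˢ-cong-≤ : ∀ n {f f′ g g′} → (∀ i → i ≤ n → f i ≡ f′ i) → (∀ i → i ≤ n → g i ≡ g′ i) →
            (f *ˢ g) n ≡ (f′ *ˢ g′) n
*ˢ-cong-≤ zero    f≡ g≡ = cong₂ _*_ (f≡ 0 z≤n) (g≡ 0 z≤n)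
*ˢ-cong-≤ (suc n) f≡ g≡ = cong₂ _+_ (cong₂ _*_ (f≡ 0 z≤n) (g≡ (suc n) ℕₚ.≤-refl))
  (*ˢ-cong-≤ n (λ i i≤n → f≡ (suc i) (s≤s i≤n)) (λ i i≤n → g≡ i (ℕₚ.m≤n⇒m≤1+n i≤n)))

*ˢ-cong : ∀ {f f′ g g′} → f ≗ f′ → g ≗ g′ → f *ˢ g ≗ f′ *ˢ g′
*ˢ-cong f≗ g≗ n = *ˢ-cong-≤ n (λ i _ → f≗ i) (λ i _ → g≗ i)

*ˢ-zeroˡ : ∀ g → 𝟘 *ˢ g ≗ 𝟘
*ˢ-zeroˡ g zero    = refl
*ˢ-zeroˡ g (suc n) = cong (_+_ (+ 0 * g (suc n))) (*ˢ-zeroˡ g n)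

*ˢ-sucʳ : ∀ f g n → (f *ˢ g) (suc n) ≡ (f *ˢ tail g) n + f (suc n) * g 0
*ˢ-sucʳ f g zero    = refl
*ˢ-sucʳ f g (suc n) = trans (cong (_+_ (f 0 * g (suc (suc n)))) (*ˢ-sucʳ (tail f) g n))
  (sym (ℤₚ.+-assoc (f 0 * g (suc (suc n))) _ _))

*ˢ-comm : ∀ f g → f *ˢ g ≗ g *ˢ f
*ˢ-comm f g zero    = ℤₚ.*-comm (f 0) (g 0)
*ˢ-comm f g (suc n) = begin
  f 0 * g (suc n) + (tail f *ˢ g) n ≡⟨ cong₂ _+_ (ℤₚ.*-comm (f 0) _) (*ˢ-comm (tail f) g n) ⟩
  g (suc n) * f 0 + (g *ˢ tail f) n ≡⟨ ℤₚ.+-comm (g (suc n) * f 0) _ ⟩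
  (g *ˢ tail f) n + g (suc n) * f 0 ≡⟨ *ˢ-sucʳ g f n ⟨
  (g *ˢ f) (suc n)                  ∎
  where open ≡-Reasoning

*ˢ-distribʳ : ∀ f f′ g → (f +ˢ f′) *ˢ g ≗ f *ˢ g +ˢ f′ *ˢ g
*ˢ-distribʳ f f′ g zero    = ℤₚ.*-distribʳ-+ (g 0) (f 0) (f′ 0)
*ˢ-distribʳ f f′ g (suc n) =
  trans (cong (_+_ ((f 0 + f′ 0) * g (suc n))) (*ˢ-distribʳ (tail f) (tail f′) g n))
        (shuffle (f 0) (f′ 0) (g (suc n)) ((tail f *ˢ g) n) ((tail f′ *ˢ g) n))
  where
  shuffle : ∀ a b c x y → (a + b) * c + (x + y) ≡ (a * c + x) + (b * c + y)
  shuffle = solve-∀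

*ˢ-distribˡ : ∀ f g g′ → f *ˢ (g +ˢ g′) ≗ f *ˢ g +ˢ f *ˢ g′
*ˢ-distribˡ f g g′ n = begin
  (f *ˢ (g +ˢ g′)) n          ≡⟨ *ˢ-comm f (g +ˢ g′) n ⟩
  ((g +ˢ g′) *ˢ f) n          ≡⟨ *ˢ-distribʳ g g′ f n ⟩
  (g *ˢ f) n + (g′ *ˢ f) n    ≡⟨ cong₂ _+_ (*ˢ-comm g f n) (*ˢ-comm g′ f n) ⟩
  (f *ˢ g) n + (f *ˢ g′) n    ∎
  where open ≡-Reasoning

·-*ˢ-assoc : ∀ c f g → (c · f) *ˢ g ≗ c · (f *ˢ g)
·-*ˢ-assoc c f g zero    = ℤₚ.*-assoc c (f 0) (g 0)
·-*ˢ-assoc c f g (suc n) =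
  trans (cong₂ _+_ (ℤₚ.*-assoc c (f 0) (g (suc n))) (·-*ˢ-assoc c (tail f) g n))
        (sym (ℤₚ.*-distribˡ-+ c _ _))

*ˢ-assoc : ∀ f g h → (f *ˢ g) *ˢ h ≗ f *ˢ (g *ˢ h)
*ˢ-assoc f g h zero    = ℤₚ.*-assoc (f 0) (g 0) (h 0)
-- tail (f *ˢ g) is definitionally f 0 · tail g +ˢ tail f *ˢ g.
*ˢ-assoc f g h (suc n) = begin
  (f 0 * g 0) * h (suc n) + ((f 0 · tail g +ˢ tail f *ˢ g) *ˢ h) n
    ≡⟨ cong (_+_ (f 0 * g 0 * h (suc n))) (*ˢ-distribʳ (f 0 · tail g) (tail f *ˢ g) h n) ⟩
  (f 0 * g 0) * h (suc n) + (((f 0 · tail g) *ˢ h) n + ((tail f *ˢ g) *ˢ h) n)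
    ≡⟨ cong₂ (λ a b → f 0 * g 0 * h (suc n) + (a + b)) (·-*ˢ-assoc (f 0) (tail g) h n) (*ˢ-assoc (tail f) g h n) ⟩
  (f 0 * g 0) * h (suc n) + (f 0 * (tail g *ˢ h) n + (tail f *ˢ (g *ˢ h)) n)
    ≡⟨ regroup (f 0) (g 0) (h (suc n)) ((tail g *ˢ h) n) ((tail f *ˢ (g *ˢ h)) n) ⟩
  f 0 * (g 0 * h (suc n) + (tail g *ˢ h) n) + (tail f *ˢ (g *ˢ h)) n ∎
  where
  open ≡-Reasoning
  regroup : ∀ a b c x y → (a * b) * c + (a * x + y) ≡ a * (b * c + x) + y
  regroup = solve-∀

*ˢ-identityˡ : ∀ f → 𝟙 *ˢ f ≗ f
*ˢ-identityˡ f zero    = ℤₚ.*-identityˡ (f 0)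
*ˢ-identityˡ f (suc n) = trans (cong₂ _+_ (ℤₚ.*-identityˡ (f (suc n))) (*ˢ-zeroˡ f n)) (ℤₚ.+-identityʳ _)

series-isCommutativeRing : IsCommutativeRing _≗_ _+ˢ_ _*ˢ_ -ˢ_ 𝟘 𝟙
series-isCommutativeRing = record
  { isRing = record
    { +-isAbelianGroup = record
      { isGroup = record
        { isMonoid = record
          { isSemigroup = record
            { isMagma = record
              { isEquivalence = Setoid.isEquivalence (ℕ →-setoid ℤ)
              ; ∙-cong = λ f≗ g≗ n → cong₂ _+_ (f≗ n) (g≗ n) }
            ; assoc = λ f g h n → ℤₚ.+-assoc (f n) (g n) (h n) }
          ; identity = (λ f n → ℤₚ.+-identityˡ (f n)) , (λ f n → ℤₚ.+-identityʳ (f n)) }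
        ; inverse = (λ f n → ℤₚ.+-inverseˡ (f n)) , (λ f n → ℤₚ.+-inverseʳ (f n))
        ; ⁻¹-cong = λ f≗ n → cong -_ (f≗ n) }
      ; comm = λ f g n → ℤₚ.+-comm (f n) (g n) }
    ; *-cong = *ˢ-cong
    ; *-assoc = *ˢ-assoc
    ; *-identity = *ˢ-identityˡ , (λ f n → trans (*ˢ-comm f 𝟙 n) (*ˢ-identityˡ f n))
    ; distrib = *ˢ-distribˡ , (λ g f f′ → *ˢ-distribʳ f f′ g) }
  ; *-comm = *ˢ-comm }

series-commutativeRing : CommutativeRing 0ℓ 0ℓ
series-commutativeRing = record { isCommutativeRing = series-isCommutativeRing }

module S = CommutativeRing series-commutativeRing
module ≗-Reasoning = Relation.Binary.Reasoning.Setoid S.setoid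
open import Algebra.Properties.Ring S.ring using (-‿distribˡ-*)

const-*-homo : ∀ a b → const (a * b) ≗ const a *ˢ const b
const-*-homo a b zero    = refl
const-*-homo a b (suc n) =
  sym (trans (cong₂ _+_ (ℤₚ.*-zeroʳ a) (*ˢ-zeroˡ (const b) n)) (ℤₚ.+-identityʳ (+ 0)))

const-*ˢ : ∀ c f → const c *ˢ f ≗ c · f
const-*ˢ c f zero    = refl
const-*ˢ c f (suc n) = trans (cong (_+_ (c * f (suc n))) (*ˢ-zeroˡ f n)) (ℤₚ.+-identityʳ _)

const-morphism : ℤ.+-*-rawRing -Raw-AlmostCommutative⟶ fromCommutativeRing series-commutativeRing
const-morphism = record
  { ⟦_⟧    = const
  ; +-homo = λ a b → λ { zero → refl ; (suc n) → refl }
  ; *-homo = const-*-homo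
  ; -‿homo = λ a → λ { zero → refl ; (suc n) → refl }
  ; 0-homo = λ { zero → refl ; (suc n) → refl }
  ; 1-homo = λ n → refl }

-- Lets the solver below recognise zero integer coefficients.
const-≟ : ∀ a b → Maybe (const a ≗ const b)
const-≟ a b with a ℤ.≟ b
... | yes refl = just (λ _ → refl)
... | no  _    = nothing

open import Algebra.Solver.Ring ℤ.+-*-rawRing (fromCommutativeRing series-commutativeRing) const-morphism const-≟
  using (solve; _:=_; con; _:+_; _:*_; :-_)

infix 4 _≈[_]_
_≈[_]_ : Series → ℕ → Series → Set
f ≈[ K ] g = ∀ i → i < K → f i ≡ g i

≗⇒≈[] : ∀ {f g K} → f ≗ g → f ≈[ K ] g
≗⇒≈[] f≗g i _ = f≗g i

≈[]-sym : ∀ {f g K} → f ≈[ K ] g → g ≈[ K ] f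
≈[]-sym f≈g i i<K = sym (f≈g i i<K)

≈[]-trans : ∀ {f g h K} → f ≈[ K ] g → g ≈[ K ] h → f ≈[ K ] h
≈[]-trans f≈g g≈h i i<K = trans (f≈g i i<K) (g≈h i i<K)

≈[]-weaken : ∀ {f g K L} → L ≤ K → f ≈[ K ] g → f ≈[ L ] g
≈[]-weaken L≤K f≈g i i<L = f≈g i (ℕₚ.<-≤-trans i<L L≤K)

+ˢ-cong-below : ∀ {f f′ g g′ K} → f ≈[ K ] f′ → g ≈[ K ] g′ → f +ˢ g ≈[ K ] f′ +ˢ g′
+ˢ-cong-below f≈ g≈ i i<K = cong₂ _+_ (f≈ i i<K) (g≈ i i<K)

*ˢ-cong-below : ∀ {K f f′ g g′} → f ≈[ K ] f′ → g ≈[ K ] g′ → f *ˢ g ≈[ K ] f′ *ˢ g′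
*ˢ-cong-below f≈ g≈ i i<K =
  *ˢ-cong-≤ i (λ j j≤i → f≈ j (ℕₚ.≤-<-trans j≤i i<K)) (λ j j≤i → g≈ j (ℕₚ.≤-<-trans j≤i i<K))

-- Finite sums and products

module BigOperator (M : CommutativeMonoid 0ℓ 0ℓ) where
  private module M = CommutativeMonoid M
  open M using (_≈_; _∙_; ε; ∙-cong; assoc; comm; identityˡ; identityʳ) renaming (Carrier to C)
  open import Relation.Binary.Reasoning.Setoid M.setoid

  big : ℕ → (ℕ → C) → C
  big zero    F = ε
  big (suc N) F = big N F ∙ F N

  big-cong : ∀ N {F G} → (∀ k → k < N → F k ≈ G k) → big N F ≈ big N G
  big-cong zero    F≈G = M.refl
  big-cong (suc N) F≈G = ∙-cong (big-cong N (λ k k<N → F≈G k (ℕₚ.m≤n⇒m≤1+n k<N))) (F≈G N ℕₚ.≤-refl)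

  big-ε : ∀ N → big N (λ _ → ε) ≈ ε
  big-ε zero    = M.refl
  big-ε (suc N) = M.trans (identityʳ _) (big-ε N)

  big-suc : ∀ N F → big (suc N) F ≈ F 0 ∙ big N (F ∘ suc)
  big-suc zero    F = M.trans (identityˡ (F 0)) (M.sym (identityʳ (F 0)))
  big-suc (suc N) F = begin
    big (suc N) F ∙ F (suc N)           ≈⟨ ∙-cong (big-suc N F) M.refl ⟩
    (F 0 ∙ big N (F ∘ suc)) ∙ F (suc N) ≈⟨ assoc _ _ _ ⟩
    F 0 ∙ big (suc N) (F ∘ suc)         ∎

  big-+ : ∀ a b F → big (a ℕ.+ b) F ≈ big a F ∙ big b (λ k → F (a ℕ.+ k))
  big-+ a zero F = begin
    big (a ℕ.+ 0) F ≡⟨ cong (λ c → big c F) (ℕₚ.+-identityʳ a) ⟩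
    big a F         ≈⟨ identityʳ _ ⟨
    big a F ∙ ε     ∎
  big-+ a (suc b) F = begin
    big (a ℕ.+ suc b) F                                 ≡⟨ cong (λ c → big c F) (ℕₚ.+-suc a b) ⟩
    big (suc (a ℕ.+ b)) F                               ≈⟨ ∙-cong (big-+ a b F) M.refl ⟩
    (big a F ∙ big b (λ k → F (a ℕ.+ k))) ∙ F (a ℕ.+ b) ≈⟨ assoc _ _ _ ⟩
    big a F ∙ big (suc b) (λ k → F (a ℕ.+ k))           ∎

  big-∙ : ∀ N F G → big N (λ k → F k ∙ G k) ≈ big N F ∙ big N G
  big-∙ zero    F G = M.sym (identityˡ ε)
  big-∙ (suc N) F G = begin
    big N (λ k → F k ∙ G k) ∙ (F N ∙ G N) ≈⟨ ∙-cong (big-∙ N F G) M.refl ⟩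
    (big N F ∙ big N G) ∙ (F N ∙ G N)     ≈⟨ interchange _ _ _ _ ⟩
    (big N F ∙ F N) ∙ (big N G ∙ G N)     ∎
    where open import Algebra.Properties.CommutativeSemigroup M.commutativeSemigroup using (interchange)

  big-reverse : ∀ N F → big N (λ i → F (N ∸ suc i)) ≈ big N F
  big-reverse zero    F = M.refl
  big-reverse (suc N) F = begin
    big (suc N) (λ i → F (suc N ∸ suc i)) ≈⟨ big-suc N (λ i → F (suc N ∸ suc i)) ⟩
    F N ∙ big N (λ i → F (N ∸ suc i))     ≈⟨ ∙-cong M.refl (big-reverse N F) ⟩
    F N ∙ big N F                         ≈⟨ comm _ _ ⟩
    big (suc N) F                         ∎

  big-extend : ∀ J d F → (∀ k → F (J ℕ.+ k) ≈ ε) → big (J ℕ.+ d) F ≈ big J F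
  big-extend J d F F≈ε = begin
    big (J ℕ.+ d) F                        ≈⟨ big-+ J d F ⟩
    big J F ∙ big d (λ k → F (J ℕ.+ k))    ≈⟨ ∙-cong M.refl (M.trans (big-cong d (λ k _ → F≈ε k)) (big-ε d)) ⟩
    big J F ∙ ε                            ≈⟨ identityʳ _ ⟩
    big J F                                ∎

  big-interleave : ∀ n F → big (n ℕ.+ n) F ≈ big n (λ i → F (2 ℕ.* i)) ∙ big n (λ i → F (suc (2 ℕ.* i)))
  big-interleave zero    F = M.sym (identityˡ ε)
  big-interleave (suc n) F = begin
    big (suc n ℕ.+ suc n) F                                 ≡⟨ cong (λ c → big (suc c) F) (ℕₚ.+-suc n n) ⟩
    (big (n ℕ.+ n) F ∙ F (n ℕ.+ n)) ∙ F (suc (n ℕ.+ n))    ≈⟨ ∙-cong (∙-cong (big-interleave n F) M.refl) M.refl ⟩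
    ((E ∙ O) ∙ F (n ℕ.+ n)) ∙ F (suc (n ℕ.+ n))            ≈⟨ ∙-cong (M.trans (assoc E O _) (M.trans (∙-cong M.refl (comm O _)) (M.sym (assoc E _ O)))) M.refl ⟩
    ((E ∙ F (n ℕ.+ n)) ∙ O) ∙ F (suc (n ℕ.+ n))            ≈⟨ assoc _ O _ ⟩
    (E ∙ F (n ℕ.+ n)) ∙ (O ∙ F (suc (n ℕ.+ n)))            ≡⟨ cong (λ c → (E ∙ F c) ∙ (O ∙ F (suc c))) n+n≡2n ⟩
    big (suc n) (λ i → F (2 ℕ.* i)) ∙ big (suc n) (λ i → F (suc (2 ℕ.* i))) ∎
    where
    E O : C
    E = big n (λ i → F (2 ℕ.* i))
    O = big n (λ i → F (suc (2 ℕ.* i)))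
    n+n≡2n : n ℕ.+ n ≡ 2 ℕ.* n
    n+n≡2n = cong (n ℕ.+_) (sym (ℕₚ.+-identityʳ n))
    swap : ∀ a b c → (a ∙ b) ∙ c ≈ (a ∙ c) ∙ b
    swap a b c = M.trans (assoc a b c) (M.trans (∙-cong M.refl (comm b c)) (M.sym (assoc a c b)))

module Σℤ = BigOperator ℤₚ.+-0-commutativeMonoid
module Σˢ = BigOperator S.+-commutativeMonoid
module Πˢ = BigOperator S.*-commutativeMonoid

sumˢ prodˢ : ℕ → (ℕ → Series) → Series
sumˢ  = Σˢ.big
prodˢ = Πˢ.big

infixr 8 _^ˢ_
_^ˢ_ : Series → ℕ → Series
f ^ˢ k = prodˢ k (λ _ → f)

sumˢ-coeff : ∀ N F j → sumˢ N F j ≡ Σℤ.big N (λ k → F k j)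
sumˢ-coeff zero    F j = refl
sumˢ-coeff (suc N) F j = cong (_+ F N j) (sumˢ-coeff N F j)

sumˢ-cong-below : ∀ N {F G K} → (∀ k → k < N → F k ≈[ K ] G k) → sumˢ N F ≈[ K ] sumˢ N G
sumˢ-cong-below zero    F≈G i i<K = refl
sumˢ-cong-below (suc N) F≈G =
  +ˢ-cong-below (sumˢ-cong-below N (λ k k<N → F≈G k (ℕₚ.m≤n⇒m≤1+n k<N))) (F≈G N ℕₚ.≤-refl)

prodˢ-cong-below : ∀ N {F G K} → (∀ k → k < N → F k ≈[ K ] G k) → prodˢ N F ≈[ K ] prodˢ N G
prodˢ-cong-below zero    F≈G i i<K = refl
prodˢ-cong-below (suc N) F≈G =
  *ˢ-cong-below (prodˢ-cong-below N (λ k k<N → F≈G k (ℕₚ.m≤n⇒m≤1+n k<N))) (F≈G N ℕₚ.≤-refl)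

^ˢ-cong-below : ∀ k {f g K} → f ≈[ K ] g → f ^ˢ k ≈[ K ] g ^ˢ k
^ˢ-cong-below k f≈g = prodˢ-cong-below k (λ _ _ → f≈g)

sumˢ-*ˢ : ∀ N F h → sumˢ N F *ˢ h ≗ sumˢ N (λ k → F k *ˢ h)
sumˢ-*ˢ zero    F h = *ˢ-zeroˡ h
sumˢ-*ˢ (suc N) F h = S.trans (*ˢ-distribʳ (sumˢ N F) (F N) h) (S.+-cong (sumˢ-*ˢ N F h) S.refl)

*ˢ-sumˢ : ∀ N h F → h *ˢ sumˢ N F ≗ sumˢ N (λ k → h *ˢ F k)
*ˢ-sumˢ N h F = S.trans (*ˢ-comm h (sumˢ N F))
  (S.trans (sumˢ-*ˢ N F h) (Σˢ.big-cong N (λ k _ → *ˢ-comm (F k) h)))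

sumˢ-const : ∀ k e → sumˢ k (λ _ → e) ≗ + k · e
sumˢ-const zero    e n = sym (ℤₚ.*-zeroˡ (e n))
sumˢ-const (suc k) e n = trans (cong (_+ e n) (sumˢ-const k e n)) (lemma (+ k) (e n))
  where
  lemma : ∀ a b → a * b + b ≡ (+ 1 + a) * b
  lemma = solve-∀

shift : ℕ → Series → Series
shift zero    f         = f
shift (suc e) f zero    = + 0
shift (suc e) f (suc n) = shift e f n

infix 9 q^_ 1-q^_
q^_ : ℕ → Series
q^ e = shift e 𝟙

1-q^_ : ℕ → Series
1-q^ e = 𝟙 +ˢ -ˢ q^ e

q^-*ˢ : ∀ e f → q^ e *ˢ f ≗ shift e f
q^-*ˢ zero    f         = *ˢ-identityˡ f
q^-*ˢ (suc e) f zero    = refl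
q^-*ˢ (suc e) f (suc n) = trans (ℤₚ.+-identityˡ _) (q^-*ˢ e f n)

shift-coeff-< : ∀ e f i → i < e → shift e f i ≡ + 0
shift-coeff-< (suc e) f zero    _         = refl
shift-coeff-< (suc e) f (suc i) (s≤s i<e) = shift-coeff-< e f i i<e

shift-coeff-+ : ∀ e f i → shift e f (e ℕ.+ i) ≡ f i
shift-coeff-+ zero    f i = refl
shift-coeff-+ (suc e) f i = shift-coeff-+ e f i

q^-coeff-< : ∀ e i → i < e → (q^ e) i ≡ + 0
q^-coeff-< e = shift-coeff-< e 𝟙

q^-coeff-+ : ∀ e i → (q^ e) (e ℕ.+ i) ≡ 𝟙 i
q^-coeff-+ e = shift-coeff-+ e 𝟙

shift-q^ : ∀ a b → shift a (q^ b) ≗ q^ (a ℕ.+ b)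
shift-q^ zero    b         = S.refl
shift-q^ (suc a) b zero    = refl
shift-q^ (suc a) b (suc n) = shift-q^ a b n

q^-+ : ∀ a b → q^ (a ℕ.+ b) ≗ q^ a *ˢ q^ b
q^-+ a b = S.sym (S.trans (q^-*ˢ a (q^ b)) (shift-q^ a b))

q^-cong : ∀ {a b} → a ≡ b → q^ a ≗ q^ b
q^-cong refl = S.refl

q^-^ˢ : ∀ e k → (q^ e) ^ˢ k ≗ q^ (e ℕ.* k)
q^-^ˢ e zero    = q^-cong (sym (ℕₚ.*-zeroʳ e))
q^-^ˢ e (suc k) = S.trans (*ˢ-cong (q^-^ˢ e k) S.refl)
  (S.trans (S.sym (q^-+ (e ℕ.* k) e)) (q^-cong (trans (ℕₚ.+-comm (e ℕ.* k) e) (sym (ℕₚ.*-suc e k)))))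

q^-*ˢ-cancel : ∀ e {f g} → q^ e *ˢ f ≗ q^ e *ˢ g → f ≗ g
q^-*ˢ-cancel e {f} {g} eq i = begin
  f i                     ≡⟨ shift-coeff-+ e f i ⟨
  shift e f (e ℕ.+ i)     ≡⟨ q^-*ˢ e f (e ℕ.+ i) ⟨
  (q^ e *ˢ f) (e ℕ.+ i)   ≡⟨ eq (e ℕ.+ i) ⟩
  (q^ e *ˢ g) (e ℕ.+ i)   ≡⟨ q^-*ˢ e g (e ℕ.+ i) ⟩
  shift e g (e ℕ.+ i)     ≡⟨ shift-coeff-+ e g i ⟩
  g i                     ∎
  where open ≡-Reasoning

q^-*ˢ-cong-below : ∀ e {f g K} → f ≈[ K ] g → q^ e *ˢ f ≈[ e ℕ.+ K ] q^ e *ˢ g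
q^-*ˢ-cong-below e {f} {g} f≈g i i<e+K =
  trans (q^-*ˢ e f i) (trans (shift-cong e f≈g i i<e+K) (sym (q^-*ˢ e g i)))
  where
  shift-cong : ∀ e {f g K} → f ≈[ K ] g → shift e f ≈[ e ℕ.+ K ] shift e g
  shift-cong zero    f≈g                   = f≈g
  shift-cong (suc e) f≈g zero    _         = refl
  shift-cong (suc e) f≈g (suc i) (s≤s i<K) = shift-cong e f≈g i i<K

≗-split-at : ∀ e {f g : Series} → (∀ i → i < e → f i ≡ g i) → (∀ t → f (e ℕ.+ t) ≡ g (e ℕ.+ t)) → f ≗ g
≗-split-at e {f} {g} low high i with i ℕₚ.<? e
... | yes i<e = low i i<e
... | no  i≮e = subst (λ j → f j ≡ g j) (ℕₚ.m+[n∸m]≡n (ℕₚ.≮⇒≥ i≮e)) (high (i ∸ e))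

D : Series → Series
D f n = + n * f n

D-cong-below : ∀ {f g K} → f ≈[ K ] g → D f ≈[ K ] D g
D-cong-below f≈g i i<K = cong (+ i *_) (f≈g i i<K)

D-*ˢ : ∀ f g → D (f *ˢ g) ≗ D f *ˢ g +ˢ f *ˢ D g
D-*ˢ f g zero    = sym (ℤₚ.+-identityˡ (f 0 * + 0) ⟨ trans ⟩ ℤₚ.*-zeroʳ (f 0))
D-*ˢ f g (suc n) = begin
  + suc n * (f 0 * g (suc n) + X)
    ≡⟨ expand (+ n) (f 0) (g (suc n)) X ⟩
  f 0 * (+ suc n * g (suc n)) + (X + + n * X)
    ≡⟨ cong (λ z → f 0 * (+ suc n * g (suc n)) + (X + z)) (D-*ˢ (tail f) g n) ⟩
  f 0 * (+ suc n * g (suc n)) + (X + ((D (tail f) *ˢ g) n + (tail f *ˢ D g) n))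
    ≡⟨ regroup (f 0 * (+ suc n * g (suc n))) X ((D (tail f) *ˢ g) n) ((tail f *ˢ D g) n) ⟩
  + 0 + ((D (tail f) *ˢ g) n + X) + (f 0 * (+ suc n * g (suc n)) + (tail f *ˢ D g) n)
    ≡⟨ cong (λ z → + 0 + z + (f 0 * (+ suc n * g (suc n)) + (tail f *ˢ D g) n)) tail-D ⟩
  + 0 + (tail (D f) *ˢ g) n + (f 0 * (+ suc n * g (suc n)) + (tail f *ˢ D g) n) ∎
  where
  open ≡-Reasoning
  X : ℤ
  X = (tail f *ˢ g) n
  expand : ∀ m a b x → (+ 1 + m) * (a * b + x) ≡ a * ((+ 1 + m) * b) + (x + m * x)
  expand = solve-∀
  regroup : ∀ a x y z → a + (x + (y + z)) ≡ + 0 + (y + x) + (a + z)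
  regroup = solve-∀
  suc-* : ∀ m a → m * a + a ≡ (+ 1 + m) * a
  suc-* = solve-∀
  tail-D : (D (tail f) *ˢ g) n + X ≡ (tail (D f) *ˢ g) n
  tail-D = trans (sym (*ˢ-distribʳ (D (tail f)) (tail f) g n))
                 (*ˢ-cong-≤ n (λ i _ → suc-* (+ i) (f (suc i))) (λ _ _ → refl))

D-𝟙 : ∀ j → D 𝟙 j ≡ + 0
D-𝟙 zero    = refl
D-𝟙 (suc j) = ℤₚ.*-zeroʳ (+ suc j)

D-q^ : ∀ e → D (q^ e) ≗ + e · q^ e
D-q^ zero    j       = trans (D-𝟙 j) (sym (ℤₚ.*-zeroˡ (𝟙 j)))
D-q^ (suc e) zero    = sym (ℤₚ.*-zeroʳ (+ suc e))
D-q^ (suc e) (suc j) = begin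
  + suc j * (q^ e) j             ≡⟨ suc-* (+ j) ((q^ e) j) ⟨
  + j * (q^ e) j + (q^ e) j      ≡⟨ cong (_+ (q^ e) j) (D-q^ e j) ⟩
  + e * (q^ e) j + (q^ e) j      ≡⟨ suc-* (+ e) ((q^ e) j) ⟩
  + suc e * (q^ e) j             ∎
  where
  open ≡-Reasoning
  suc-* : ∀ m a → m * a + a ≡ (+ 1 + m) * a
  suc-* = solve-∀

sgn-+ : ∀ a b → sgn (a ℕ.+ b) ≡ sgn a * sgn b
sgn-+ zero    b = sym (ℤₚ.*-identityˡ (sgn b))
sgn-+ (suc a) b = trans (cong -_ (sgn-+ a b)) (ℤₚ.neg-distribˡ-* (sgn a) (sgn b))

sgn-*-sgn : ∀ n → sgn n * sgn n ≡ + 1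
sgn-*-sgn zero    = refl
sgn-*-sgn (suc n) = trans (neg-*-neg (sgn n)) (sgn-*-sgn n)
  where
  neg-*-neg : ∀ s → - s * - s ≡ s * s
  neg-*-neg = solve-∀

sgn-*-sgn-+ : ∀ a b → sgn a * sgn (a ℕ.+ b) ≡ sgn b
sgn-*-sgn-+ a b = begin
  sgn a * sgn (a ℕ.+ b)       ≡⟨ cong (sgn a *_) (sgn-+ a b) ⟩
  sgn a * (sgn a * sgn b)     ≡⟨ ℤₚ.*-assoc (sgn a) (sgn a) (sgn b) ⟨
  sgn a * sgn a * sgn b       ≡⟨ cong (_* sgn b) (sgn-*-sgn a) ⟩
  + 1 * sgn b                 ≡⟨ ℤₚ.*-identityˡ (sgn b) ⟩
  sgn b                       ∎
  where open ≡-Reasoning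

sgn-square : ∀ i → sgn (i ℕ.* i) ≡ sgn i
sgn-square zero    = refl
sgn-square (suc i) = begin
  sgn (suc i ℕ.* suc i)                   ≡⟨ cong sgn (square-suc i) ⟩
  - sgn (i ℕ.* i ℕ.+ (i ℕ.+ i))           ≡⟨ cong -_ (sgn-+ (i ℕ.* i) (i ℕ.+ i)) ⟩
  - (sgn (i ℕ.* i) * sgn (i ℕ.+ i))       ≡⟨ cong (λ s → - (s * sgn (i ℕ.+ i))) (sgn-square i) ⟩
  - (sgn i * sgn (i ℕ.+ i))               ≡⟨ cong (λ s → - (sgn i * s)) (trans (sgn-+ i i) (sgn-*-sgn i)) ⟩
  - (sgn i * + 1)                         ≡⟨ cong -_ (ℤₚ.*-identityʳ (sgn i)) ⟩
  sgn (suc i)                             ∎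
  where
  open ≡-Reasoning
  square-suc : ∀ i → (1 ℕ.+ i) ℕ.* (1 ℕ.+ i) ≡ 1 ℕ.+ (i ℕ.* i ℕ.+ (i ℕ.+ i))
  square-suc = ℕ-Solver.solve-∀

alt : Series → Series
alt f n = sgn n * f n

alt-+ˢ : ∀ f g → alt (f +ˢ g) ≗ alt f +ˢ alt g
alt-+ˢ f g n = ℤₚ.*-distribˡ-+ (sgn n) (f n) (g n)

alt-*ˢ : ∀ f g → alt (f *ˢ g) ≗ alt f *ˢ alt g
alt-*ˢ f g zero    = sign-lemma (f 0) (g 0)
  where
  sign-lemma : ∀ a b → + 1 * (a * b) ≡ (+ 1 * a) * (+ 1 * b)
  sign-lemma = solve-∀
alt-*ˢ f g (suc n) = sym (begin
  (+ 1 * f 0) * (- sgn n * g (suc n)) + (tail (alt f) *ˢ alt g) n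
    ≡⟨ cong (_+_ ((+ 1 * f 0) * (- sgn n * g (suc n)))) tail-alt ⟩
  (+ 1 * f 0) * (- sgn n * g (suc n)) + - (sgn n * (tail f *ˢ g) n)
    ≡⟨ sign-lemma (sgn n) (f 0) (g (suc n)) ((tail f *ˢ g) n) ⟩
  - sgn n * (f 0 * g (suc n) + (tail f *ˢ g) n) ∎)
  where
  open ≡-Reasoning
  sign-lemma : ∀ s a b x → (+ 1 * a) * (- s * b) + - (s * x) ≡ - s * (a * b + x)
  sign-lemma = solve-∀
  tail-alt : (tail (alt f) *ˢ alt g) n ≡ - (sgn n * (tail f *ˢ g) n)
  tail-alt = begin
    (tail (alt f) *ˢ alt g) n     ≡⟨ *ˢ-cong (λ i → sym (ℤₚ.neg-distribˡ-* (sgn i) (f (suc i)))) S.refl n ⟩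
    ((-ˢ alt (tail f)) *ˢ alt g) n ≡⟨ -‿distribˡ-* (alt (tail f)) (alt g) n ⟨
    - (alt (tail f) *ˢ alt g) n    ≡⟨ cong -_ (alt-*ˢ (tail f) g n) ⟨
    - (sgn n * (tail f *ˢ g) n)    ∎

alt-sumˢ : ∀ N F → alt (sumˢ N F) ≗ sumˢ N (alt ∘ F)
alt-sumˢ zero    F n = ℤₚ.*-zeroʳ (sgn n)
alt-sumˢ (suc N) F   = S.trans (alt-+ˢ (sumˢ N F) (F N)) (S.+-cong (alt-sumˢ N F) S.refl)

alt-prodˢ : ∀ N F → alt (prodˢ N F) ≗ prodˢ N (alt ∘ F)
alt-prodˢ zero    F zero    = refl
alt-prodˢ zero    F (suc n) = ℤₚ.*-zeroʳ (sgn (suc n))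
alt-prodˢ (suc N) F         = S.trans (alt-*ˢ (prodˢ N F) (F N)) (*ˢ-cong (alt-prodˢ N F) S.refl)

alt-^ˢ : ∀ f k → alt (f ^ˢ k) ≗ alt f ^ˢ k
alt-^ˢ f k = alt-prodˢ k (λ _ → f)

alt-q^ : ∀ e → alt (q^ e) ≗ sgn e · q^ e
alt-q^ zero    zero    = refl
alt-q^ zero    (suc j) = trans (ℤₚ.*-zeroʳ (sgn (suc j))) (sym (ℤₚ.*-zeroʳ (+ 1)))
alt-q^ (suc e) zero    = trans (ℤₚ.*-zeroʳ (+ 1)) (sym (ℤₚ.*-zeroʳ (sgn (suc e))))
alt-q^ (suc e) (suc j) = begin
  - sgn j * (q^ e) j     ≡⟨ ℤₚ.neg-distribˡ-* (sgn j) ((q^ e) j) ⟨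
  - (sgn j * (q^ e) j)   ≡⟨ cong -_ (alt-q^ e j) ⟩
  - (sgn e * (q^ e) j)   ≡⟨ ℤₚ.neg-distribˡ-* (sgn e) ((q^ e) j) ⟩
  - sgn e * (q^ e) j     ∎
  where open ≡-Reasoning

-- e = -q f′ / f, stated without division.
NegLogDeriv : Series → Series → Set
NegLogDeriv f e = D f ≗ -ˢ (e *ˢ f)

NegLogDeriv-𝟙 : NegLogDeriv 𝟙 𝟘
NegLogDeriv-𝟙 zero    = refl
NegLogDeriv-𝟙 (suc n) = trans (ℤₚ.*-zeroʳ (+ suc n)) (sym (cong -_ (*ˢ-zeroˡ 𝟙 (suc n))))

NegLogDeriv-*ˢ : ∀ {f g e e′} → NegLogDeriv f e → NegLogDeriv g e′ → NegLogDeriv (f *ˢ g) (e +ˢ e′)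
NegLogDeriv-*ˢ {f} {g} {e} {e′} f-e g-e′ = begin
  D (f *ˢ g)                                        ≈⟨ D-*ˢ f g ⟩
  D f *ˢ g +ˢ f *ˢ D g                              ≈⟨ S.+-cong (*ˢ-cong f-e S.refl) (*ˢ-cong S.refl g-e′) ⟩
  (-ˢ (e *ˢ f)) *ˢ g +ˢ f *ˢ (-ˢ (e′ *ˢ g))         ≈⟨ solve 4 (λ f g e e′ → (:- (e :* f)) :* g :+ f :* (:- (e′ :* g))
                                                                     := :- ((e :+ e′) :* (f :* g))) (λ _ → refl) f g e e′ ⟩
  -ˢ ((e +ˢ e′) *ˢ (f *ˢ g))                         ∎
  where open ≗-Reasoning

NegLogDeriv-prodˢ : ∀ N {F E} → (∀ i → NegLogDeriv (F i) (E i)) → NegLogDeriv (prodˢ N F) (sumˢ N E)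
NegLogDeriv-prodˢ zero    _ = NegLogDeriv-𝟙
NegLogDeriv-prodˢ (suc N) F-E = NegLogDeriv-*ˢ (NegLogDeriv-prodˢ N F-E) (F-E N)

NegLogDeriv-^ˢ : ∀ k {f e} → NegLogDeriv f e → NegLogDeriv (f ^ˢ k) (+ k · e)
NegLogDeriv-^ˢ k {f} {e} f-e = S.trans (NegLogDeriv-prodˢ k (λ _ → f-e))
  (λ n → cong -_ (*ˢ-cong (sumˢ-const k e) S.refl n))

NegLogDeriv-below : ∀ {f f′ e e′ K} → f ≈[ K ] f′ → e ≈[ K ] e′ → NegLogDeriv f e →
                    D f′ ≈[ K ] -ˢ (e′ *ˢ f′)
NegLogDeriv-below f≈f′ e≈e′ f-e = ≈[]-trans (D-cong-below (≈[]-sym f≈f′))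
  (≈[]-trans (≗⇒≈[] f-e) (λ i i<K → cong -_ (*ˢ-cong-below e≈e′ f≈f′ i i<K)))

1-q^0 : 1-q^ 0 ≗ 𝟘
1-q^0 zero    = refl
1-q^0 (suc n) = refl

1-q^-below : ∀ e → 1-q^ e ≈[ e ] 𝟙
1-q^-below e i i<e = trans (cong (λ z → 𝟙 i + - z) (q^-coeff-< e i i<e)) (ℤₚ.+-identityʳ (𝟙 i))

prodˢ-below-𝟙 : ∀ N {F K} → (∀ i → i < N → F i ≈[ K ] 𝟙) → prodˢ N F ≈[ K ] 𝟙
prodˢ-below-𝟙 N F≈𝟙 = ≈[]-trans (prodˢ-cong-below N F≈𝟙) (≗⇒≈[] (Πˢ.big-ε N))

*ˢ-below-𝟙 : ∀ {f a K} → a ≈[ K ] 𝟙 → f *ˢ a ≈[ K ] f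
*ˢ-below-𝟙 {f} a≈𝟙 = ≈[]-trans (*ˢ-cong-below (λ i _ → refl {x = f i}) a≈𝟙) (≗⇒≈[] (S.*-identityʳ f))

-- The finite q-binomial theorem

-- Gaussian binomial coefficients in base q².
qBinom : ℕ → ℕ → Series
qBinom N       zero    = 𝟙
qBinom zero    (suc k) = 𝟘
qBinom (suc N) (suc k) = q^ (2 ℕ.* suc k) *ˢ qBinom N (suc k) +ˢ qBinom N k

q²-poch : ℕ → Series
q²-poch k = prodˢ k (λ i → 1-q^ (2 ℕ.* suc i))

-- (1 - q^(2N)) (1 - q^(2N-2)) ⋯, k factors; for k > N the truncated exponent produces 1 - q⁰ = 0.
q²-falling : ℕ → ℕ → Series
q²-falling N k = prodˢ k (λ i → 1-q^ (2 ℕ.* (N ∸ i)))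

qBinom-above : ∀ N k → N < k → qBinom N k ≗ 𝟘
qBinom-above zero    (suc k) _         = S.refl
qBinom-above (suc N) (suc k) (s≤s N<k) = begin
  q^ (2 ℕ.* suc k) *ˢ qBinom N (suc k) +ˢ qBinom N k
    ≈⟨ S.+-cong (*ˢ-cong S.refl (qBinom-above N (suc k) (ℕₚ.m≤n⇒m≤1+n N<k))) (qBinom-above N k N<k) ⟩
  q^ (2 ℕ.* suc k) *ˢ 𝟘 +ˢ 𝟘 ≈⟨ S.trans (S.+-identityʳ _) (S.zeroʳ _) ⟩
  𝟘                          ∎
  where open ≗-Reasoning

q²-falling-above : ∀ N k → N < k → q²-falling N k ≗ 𝟘
q²-falling-above N (suc k) N<1+k with N ℕₚ.≟ k
... | yes refl = S.trans (*ˢ-cong S.refl (S.trans last-factor 1-q^0)) (S.zeroʳ _)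
  where
  last-factor : 1-q^ (2 ℕ.* (N ∸ N)) ≗ 1-q^ 0
  last-factor j = cong (λ e → (1-q^ (2 ℕ.* e)) j) (ℕₚ.n∸n≡0 N)
... | no  N≢k  = S.trans (*ˢ-cong (q²-falling-above N k (ℕₚ.≤∧≢⇒< (ℕₚ.≤-pred N<1+k) N≢k)) S.refl) (S.zeroˡ _)

qBinom-*ˢ-q²-poch : ∀ N k → qBinom N k *ˢ q²-poch k ≗ q²-falling N k
qBinom-*ˢ-q²-poch N       zero    = *ˢ-identityˡ 𝟙
qBinom-*ˢ-q²-poch zero    (suc k) = S.trans (S.zeroˡ _) (S.sym (q²-falling-above zero (suc k) (s≤s z≤n)))
qBinom-*ˢ-q²-poch (suc N) (suc k) = begin
  (a *ˢ A +ˢ B) *ˢ (q²-poch k *ˢ (𝟙 +ˢ -ˢ a))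
    ≈⟨ solve 4 (λ a A B P → (a :* A :+ B) :* (P :* (con (+ 1) :+ :- a))
                           := a :* (A :* (P :* (con (+ 1) :+ :- a))) :+ (B :* P) :* (con (+ 1) :+ :- a))
               (λ _ → refl) a A B (q²-poch k) ⟩
  a *ˢ (A *ˢ q²-poch (suc k)) +ˢ (B *ˢ q²-poch k) *ˢ (𝟙 +ˢ -ˢ a)
    ≈⟨ S.+-cong (*ˢ-cong S.refl (qBinom-*ˢ-q²-poch N (suc k))) (*ˢ-cong (qBinom-*ˢ-q²-poch N k) S.refl) ⟩
  a *ˢ (F *ˢ 1-q^ (2 ℕ.* (N ∸ k))) +ˢ F *ˢ (𝟙 +ˢ -ˢ a)
    ≈⟨ pascal-factor ⟩
  1-q^ (2 ℕ.* suc N) *ˢ F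
    ≈⟨ Πˢ.big-suc k (λ i → 1-q^ (2 ℕ.* (suc N ∸ i))) ⟨
  q²-falling (suc N) (suc k) ∎
  where
  open ≗-Reasoning
  a A B F : Series
  a = q^ (2 ℕ.* suc k)
  A = qBinom N (suc k)
  B = qBinom N k
  F = q²-falling N k
  pascal-factor : a *ˢ (F *ˢ 1-q^ (2 ℕ.* (N ∸ k))) +ˢ F *ˢ (𝟙 +ˢ -ˢ a) ≗ 1-q^ (2 ℕ.* suc N) *ˢ F
  pascal-factor with k ℕₚ.≤? N
  ... | yes k≤N = begin
    a *ˢ (F *ˢ (𝟙 +ˢ -ˢ b)) +ˢ F *ˢ (𝟙 +ˢ -ˢ a)
      ≈⟨ solve 3 (λ a b F → a :* (F :* (con (+ 1) :+ :- b)) :+ F :* (con (+ 1) :+ :- a)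
                          := (con (+ 1) :+ :- (a :* b)) :* F) (λ _ → refl) a b F ⟩
    (𝟙 +ˢ -ˢ (a *ˢ b)) *ˢ F
      ≈⟨ *ˢ-cong (S.+-cong (S.refl {𝟙}) (S.-‿cong (S.sym (S.trans (q^-cong exponent) (q^-+ (2 ℕ.* suc k) (2 ℕ.* (N ∸ k))))))) S.refl ⟩
    1-q^ (2 ℕ.* suc N) *ˢ F ∎
    where
    b : Series
    b = q^ (2 ℕ.* (N ∸ k))
    exponent : 2 ℕ.* suc N ≡ 2 ℕ.* suc k ℕ.+ 2 ℕ.* (N ∸ k)
    exponent = trans (cong (λ m → 2 ℕ.* suc m) (sym (ℕₚ.m+[n∸m]≡n k≤N))) (ℕₚ.*-distribˡ-+ 2 (suc k) (N ∸ k))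
  ... | no k≰N = begin
    a *ˢ (F *ˢ b) +ˢ F *ˢ (𝟙 +ˢ -ˢ a)
      ≈⟨ solve 3 (λ a b F → a :* (F :* b) :+ F :* (con (+ 1) :+ :- a) := F :* (a :* b :+ con (+ 1) :+ :- a))
               (λ _ → refl) a b F ⟩
    F *ˢ (a *ˢ b +ˢ 𝟙 +ˢ -ˢ a)  ≈⟨ *ˢ-cong F≗𝟘 S.refl ⟩
    𝟘 *ˢ (a *ˢ b +ˢ 𝟙 +ˢ -ˢ a)  ≈⟨ S.zeroˡ _ ⟩
    𝟘                           ≈⟨ S.zeroʳ _ ⟨
    1-q^ (2 ℕ.* suc N) *ˢ 𝟘     ≈⟨ *ˢ-cong S.refl F≗𝟘 ⟨
    1-q^ (2 ℕ.* suc N) *ˢ F     ∎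
    where
    b : Series
    b = 1-q^ (2 ℕ.* (N ∸ k))
    F≗𝟘 : F ≗ 𝟘
    F≗𝟘 = q²-falling-above N k (ℕₚ.≰⇒> k≰N)

q²-falling-below-𝟙 : ∀ N k → k ≤ N → q²-falling N k ≈[ 2 ℕ.* suc (N ∸ k) ] 𝟙
q²-falling-below-𝟙 N k k≤N = prodˢ-below-𝟙 k (λ i i<k →
  ≈[]-weaken (ℕₚ.*-monoʳ-≤ 2 (ℕₚ.∸-monoʳ-< i<k k≤N)) (1-q^-below (2 ℕ.* (N ∸ i))))

q²-poch-stable : ∀ j n → j ≤ n → q²-poch n ≈[ 2 ℕ.* suc j ] q²-poch j
q²-poch-stable j n j≤n =
  ≈[]-trans (λ i _ → cong (λ m → q²-poch m i) (sym (ℕₚ.m+[n∸m]≡n j≤n)))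
  (≈[]-trans (≗⇒≈[] (Πˢ.big-+ j (n ∸ j) (λ i → 1-q^ (2 ℕ.* suc i))))
  (*ˢ-below-𝟙 (prodˢ-below-𝟙 (n ∸ j) (λ i _ →
     ≈[]-weaken (ℕₚ.*-monoʳ-≤ 2 (s≤s (ℕₚ.m≤m+n j i))) (1-q^-below (2 ℕ.* suc (j ℕ.+ i)))))))

qBinom-*ˢ-q²-poch-below-𝟙 : ∀ N k n L → k ≤ N → L ≤ k → L ≤ N ∸ k → L ≤ n →
                            qBinom N k *ˢ q²-poch n ≈[ 2 ℕ.* suc L ] 𝟙
qBinom-*ˢ-q²-poch-below-𝟙 N k n L k≤N L≤k L≤N∸k L≤n =
  ≈[]-trans (*ˢ-cong-below (λ i _ → refl {x = qBinom N k i})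
                           (≈[]-trans (q²-poch-stable L n L≤n) (≈[]-sym (q²-poch-stable L k L≤k))))
  (≈[]-trans (≗⇒≈[] (qBinom-*ˢ-q²-poch N k))
             (≈[]-weaken (ℕₚ.*-monoʳ-≤ 2 (s≤s L≤N∸k)) (q²-falling-below-𝟙 N k k≤N)))

cauchyTerm : ℕ → Series → Series → ℕ → Series
cauchyTerm N x y k = qBinom N k *ˢ (q^ (k ℕ.* pred k) *ˢ (x ^ˢ (N ∸ k) *ˢ y ^ˢ k))

k*pred-k+2k : ∀ k → k ℕ.* pred k ℕ.+ 2 ℕ.* k ≡ suc k ℕ.* k
k*pred-k+2k zero    = refl
k*pred-k+2k (suc k) = lemma k
  where
  lemma : ∀ k → (1 ℕ.+ k) ℕ.* k ℕ.+ 2 ℕ.* (1 ℕ.+ k) ≡ (2 ℕ.+ k) ℕ.* (1 ℕ.+ k)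
  lemma = ℕ-Solver.solve-∀

module CauchyStep (N : ℕ) (x y : Series) where
  open ≗-Reasoning

  y′ : Series
  y′ = q^ 2 *ˢ y

  y′-^ˢ : ∀ k → y′ ^ˢ k ≗ q^ (2 ℕ.* k) *ˢ y ^ˢ k
  y′-^ˢ k = S.trans (Πˢ.big-∙ k (λ _ → q^ 2) (λ _ → y)) (*ˢ-cong (q^-^ˢ 2 k) S.refl)

  rest : ℕ → Series
  rest k = q^ (suc k ℕ.* k) *ˢ (x ^ˢ (N ∸ k) *ˢ y ^ˢ suc k)

  term-*ˢ-y : ∀ k → cauchyTerm N x y′ k *ˢ y ≗ qBinom N k *ˢ rest k
  term-*ˢ-y k = begin
    qBinom N k *ˢ (q^ (k ℕ.* pred k) *ˢ (x ^ˢ (N ∸ k) *ˢ y′ ^ˢ k)) *ˢ y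
      ≈⟨ *ˢ-cong (*ˢ-cong S.refl (*ˢ-cong S.refl (*ˢ-cong S.refl (y′-^ˢ k)))) S.refl ⟩
    qBinom N k *ˢ (q^ (k ℕ.* pred k) *ˢ (x ^ˢ (N ∸ k) *ˢ (q^ (2 ℕ.* k) *ˢ y ^ˢ k))) *ˢ y
      ≈⟨ solve 6 (λ b m₁ m₂ xs ys y → (b :* (m₁ :* (xs :* (m₂ :* ys)))) :* y
                                    := b :* ((m₁ :* m₂) :* (xs :* (ys :* y))))
               (λ _ → refl) (qBinom N k) (q^ (k ℕ.* pred k)) (q^ (2 ℕ.* k)) (x ^ˢ (N ∸ k)) (y ^ˢ k) y ⟩
    qBinom N k *ˢ ((q^ (k ℕ.* pred k) *ˢ q^ (2 ℕ.* k)) *ˢ (x ^ˢ (N ∸ k) *ˢ y ^ˢ suc k))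
      ≈⟨ *ˢ-cong S.refl (*ˢ-cong (S.trans (S.sym (q^-+ (k ℕ.* pred k) (2 ℕ.* k))) (q^-cong (k*pred-k+2k k))) S.refl) ⟩
    qBinom N k *ˢ rest k ∎

  term-*ˢ-x : ∀ k → k < N → cauchyTerm N x y′ (suc k) *ˢ x ≗ q^ (2 ℕ.* suc k) *ˢ qBinom N (suc k) *ˢ rest k
  term-*ˢ-x k k<N = begin
    qBinom N (suc k) *ˢ (q^ (suc k ℕ.* k) *ˢ (x ^ˢ (N ∸ suc k) *ˢ y′ ^ˢ suc k)) *ˢ x
      ≈⟨ *ˢ-cong (*ˢ-cong S.refl (*ˢ-cong S.refl (*ˢ-cong S.refl (y′-^ˢ (suc k))))) S.refl ⟩
    qBinom N (suc k) *ˢ (q^ (suc k ℕ.* k) *ˢ (x ^ˢ (N ∸ suc k) *ˢ (q^ (2 ℕ.* suc k) *ˢ y ^ˢ suc k))) *ˢ x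
      ≈⟨ solve 6 (λ b m a xs ys x → (b :* (m :* (xs :* (a :* ys)))) :* x
                                  := (a :* b) :* (m :* ((xs :* x) :* ys)))
               (λ _ → refl) (qBinom N (suc k)) (q^ (suc k ℕ.* k)) (q^ (2 ℕ.* suc k)) (x ^ˢ (N ∸ suc k)) (y ^ˢ suc k) x ⟩
    q^ (2 ℕ.* suc k) *ˢ qBinom N (suc k) *ˢ (q^ (suc k ℕ.* k) *ˢ (x ^ˢ suc (N ∸ suc k) *ˢ y ^ˢ suc k))
      ≡⟨ cong (λ m → q^ (2 ℕ.* suc k) *ˢ qBinom N (suc k) *ˢ (q^ (suc k ℕ.* k) *ˢ (x ^ˢ m *ˢ y ^ˢ suc k)))
              (sym (ℕₚ.+-∸-assoc 1 k<N)) ⟩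
    q^ (2 ℕ.* suc k) *ˢ qBinom N (suc k) *ˢ rest k ∎

  sum-*ˢ-x : sumˢ (suc N) (cauchyTerm N x y′) *ˢ x ≗
             x ^ˢ suc N +ˢ sumˢ (suc N) (λ k → q^ (2 ℕ.* suc k) *ˢ qBinom N (suc k) *ˢ rest k)
  sum-*ˢ-x = begin
    sumˢ (suc N) (cauchyTerm N x y′) *ˢ x
      ≈⟨ sumˢ-*ˢ (suc N) (cauchyTerm N x y′) x ⟩
    sumˢ (suc N) (λ k → cauchyTerm N x y′ k *ˢ x)
      ≈⟨ Σˢ.big-suc N (λ k → cauchyTerm N x y′ k *ˢ x) ⟩
    cauchyTerm N x y′ 0 *ˢ x +ˢ sumˢ N (λ k → cauchyTerm N x y′ (suc k) *ˢ x)
      ≈⟨ S.+-cong (solve 2 (λ xs x → (con (+ 1) :* (con (+ 1) :* (xs :* con (+ 1)))) :* x := xs :* x)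
                           (λ _ → refl) (x ^ˢ N) x)
                  (Σˢ.big-cong N term-*ˢ-x) ⟩
    x ^ˢ suc N +ˢ sumˢ N A
      ≈⟨ S.+-cong (S.refl {x ^ˢ suc N}) (S.trans (S.sym (S.+-identityʳ (sumˢ N A))) (S.+-cong (S.refl {sumˢ N A}) (S.sym A-N≗𝟘))) ⟩
    x ^ˢ suc N +ˢ sumˢ (suc N) A ∎
    where
    A : ℕ → Series
    A k = q^ (2 ℕ.* suc k) *ˢ qBinom N (suc k) *ˢ rest k
    A-N≗𝟘 : A N ≗ 𝟘
    A-N≗𝟘 = S.trans (*ˢ-cong (S.trans (*ˢ-cong S.refl (qBinom-above N (suc N) ℕₚ.≤-refl)) (S.zeroʳ _)) S.refl)
                    (S.zeroˡ _)

  step : (x +ˢ y) *ˢ sumˢ (suc N) (cauchyTerm N x y′) ≗ sumˢ (suc (suc N)) (cauchyTerm (suc N) x y)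
  step = begin
    (x +ˢ y) *ˢ T
      ≈⟨ S.trans (*ˢ-comm (x +ˢ y) T) (*ˢ-distribˡ T x y) ⟩
    T *ˢ x +ˢ T *ˢ y
      ≈⟨ S.+-cong sum-*ˢ-x (S.trans (sumˢ-*ˢ (suc N) (cauchyTerm N x y′) y) (Σˢ.big-cong (suc N) (λ k _ → term-*ˢ-y k))) ⟩
    (x ^ˢ suc N +ˢ sumˢ (suc N) A) +ˢ sumˢ (suc N) B
      ≈⟨ S.+-assoc (x ^ˢ suc N) (sumˢ (suc N) A) (sumˢ (suc N) B) ⟩
    x ^ˢ suc N +ˢ (sumˢ (suc N) A +ˢ sumˢ (suc N) B)
      ≈⟨ S.+-cong (x^-as-term) (S.sym (Σˢ.big-∙ (suc N) A B)) ⟩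
    cauchyTerm (suc N) x y 0 +ˢ sumˢ (suc N) (λ k → A k +ˢ B k)
      ≈⟨ S.+-cong (S.refl {cauchyTerm (suc N) x y 0})
                  (Σˢ.big-cong (suc N) (λ k _ → S.sym (*ˢ-distribʳ (q^ (2 ℕ.* suc k) *ˢ qBinom N (suc k)) (qBinom N k) (rest k)))) ⟩
    cauchyTerm (suc N) x y 0 +ˢ sumˢ (suc N) (λ k → cauchyTerm (suc N) x y (suc k))
      ≈⟨ Σˢ.big-suc (suc N) (cauchyTerm (suc N) x y) ⟨
    sumˢ (suc (suc N)) (cauchyTerm (suc N) x y) ∎
    where
    T : Series
    T = sumˢ (suc N) (cauchyTerm N x y′)
    A B : ℕ → Series
    A k = q^ (2 ℕ.* suc k) *ˢ qBinom N (suc k) *ˢ rest k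
    B k = qBinom N k *ˢ rest k
    x^-as-term : x ^ˢ suc N ≗ cauchyTerm (suc N) x y 0
    x^-as-term = solve 1 (λ xs → xs := con (+ 1) :* (con (+ 1) :* (xs :* con (+ 1)))) (λ _ → refl) (x ^ˢ suc N)

cauchy-binomial : ∀ N x y → prodˢ N (λ i → x +ˢ q^ (2 ℕ.* i) *ˢ y) ≗ sumˢ (suc N) (cauchyTerm N x y)
cauchy-binomial zero    x y = S.sym (S.trans (S.+-identityˡ _)
  (solve 0 (con (+ 1) :* (con (+ 1) :* (con (+ 1) :* con (+ 1))) := con (+ 1)) (λ _ → refl)))
cauchy-binomial (suc N) x y = begin
  prodˢ (suc N) (λ i → x +ˢ q^ (2 ℕ.* i) *ˢ y)
    ≈⟨ Πˢ.big-suc N (λ i → x +ˢ q^ (2 ℕ.* i) *ˢ y) ⟩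
  (x +ˢ 𝟙 *ˢ y) *ˢ prodˢ N (λ i → x +ˢ q^ (2 ℕ.* suc i) *ˢ y)
    ≈⟨ *ˢ-cong (S.+-cong (S.refl {x}) (*ˢ-identityˡ y)) (Πˢ.big-cong N (λ i _ → S.+-cong (S.refl {x}) (factor i))) ⟩
  (x +ˢ y) *ˢ prodˢ N (λ i → x +ˢ q^ (2 ℕ.* i) *ˢ y′)
    ≈⟨ *ˢ-cong S.refl (cauchy-binomial N x y′) ⟩
  (x +ˢ y) *ˢ sumˢ (suc N) (cauchyTerm N x y′)
    ≈⟨ step ⟩
  sumˢ (suc (suc N)) (cauchyTerm (suc N) x y) ∎
  where
  open ≗-Reasoning
  open CauchyStep N x y
  factor : ∀ i → q^ (2 ℕ.* suc i) *ˢ y ≗ q^ (2 ℕ.* i) *ˢ y′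
  factor i = begin
    q^ (2 ℕ.* suc i) *ˢ y        ≈⟨ *ˢ-cong (S.trans (q^-cong (ℕₚ.*-suc 2 i)) (q^-+ 2 (2 ℕ.* i))) S.refl ⟩
    q^ 2 *ˢ q^ (2 ℕ.* i) *ˢ y    ≈⟨ solve 3 (λ a b y → a :* b :* y := b :* (a :* y)) (λ _ → refl) (q^ 2) (q^ (2 ℕ.* i)) y ⟩
    q^ (2 ℕ.* i) *ˢ y′           ∎

-- Jacobi's triple product modulo q^(2n+1)

∣-∣-cases : ∀ k n → k ℕ.+ ∣ k - n ∣ ≡ n ⊎ k ≡ n ℕ.+ ∣ k - n ∣
∣-∣-cases zero    n       = inj₁ refl
∣-∣-cases (suc k) zero    = inj₂ refl
∣-∣-cases (suc k) (suc n) = Sum.map (cong suc) (cong suc) (∣-∣-cases k n)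

∣-∣≤ : ∀ n k → k ≤ n ℕ.+ n → ∣ k - n ∣ ≤ n
∣-∣≤ n k k≤2n with ∣ k - n ∣ | ∣-∣-cases k n
... | d | inj₁ k+d≡n = subst (d ≤_) k+d≡n (ℕₚ.m≤n+m d k)
... | d | inj₂ refl  = ℕₚ.+-cancelˡ-≤ n d n k≤2n

-- n (n - 1) + (2n - 1) n for n = m + 1: the power of q that both sides of the q-binomial theorem
-- share in the specialisation below.
tripleExponent : ℕ → ℕ
tripleExponent m = suc m ℕ.* m ℕ.+ suc (2 ℕ.* m) ℕ.* suc m

exponent-shift : ∀ m k → k ≤ suc m ℕ.+ suc m →
  k ℕ.* pred k ℕ.+ suc (2 ℕ.* m) ℕ.* ((suc m ℕ.+ suc m) ∸ k) ≡
  tripleExponent m ℕ.+ ∣ k - suc m ∣ ℕ.* ∣ k - suc m ∣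
exponent-shift m k k≤2n with ∣ k - suc m ∣ | ∣-∣-cases k (suc m)
exponent-shift m zero    _ | d | inj₁ refl = lemma m
  where
  lemma : ∀ m → suc (2 ℕ.* m) ℕ.* (suc m ℕ.+ suc m) ≡
                (suc m ℕ.* m ℕ.+ suc (2 ℕ.* m) ℕ.* suc m) ℕ.+ suc m ℕ.* suc m
  lemma = ℕ-Solver.solve-∀
exponent-shift m (suc k) _ | d | inj₁ k+d≡m with refl ← ℕₚ.suc-injective k+d≡m =
  trans (cong (λ z → suc k ℕ.* k ℕ.+ suc (2 ℕ.* (k ℕ.+ d)) ℕ.* z) difference) (lemma k d)
  where
  difference : (suc (k ℕ.+ d) ℕ.+ suc (k ℕ.+ d)) ∸ suc k ≡ d ℕ.+ suc (k ℕ.+ d)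
  difference = trans (cong (_∸ k) (ℕₚ.+-assoc k d (suc (k ℕ.+ d)))) (ℕₚ.m+n∸m≡n k (d ℕ.+ suc (k ℕ.+ d)))
  lemma : ∀ k d → suc k ℕ.* k ℕ.+ suc (2 ℕ.* (k ℕ.+ d)) ℕ.* (d ℕ.+ suc (k ℕ.+ d)) ≡
                  (suc (k ℕ.+ d) ℕ.* (k ℕ.+ d) ℕ.+ suc (2 ℕ.* (k ℕ.+ d)) ℕ.* suc (k ℕ.+ d)) ℕ.+ d ℕ.* d
  lemma = ℕ-Solver.solve-∀
exponent-shift m k k≤2n | d | inj₂ refl =
  trans (cong (λ z → suc (m ℕ.+ d) ℕ.* (m ℕ.+ d) ℕ.+ suc (2 ℕ.* m) ℕ.* z) (ℕₚ.[m+n]∸[m+o]≡n∸o (suc m) (suc m) d))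
        (above m d (suc m ∸ d) (sym (ℕₚ.m+[n∸m]≡n (ℕₚ.+-cancelˡ-≤ (suc m) d (suc m) k≤2n))))
  where
  above : ∀ m d r → suc m ≡ d ℕ.+ r →
          suc (m ℕ.+ d) ℕ.* (m ℕ.+ d) ℕ.+ suc (2 ℕ.* m) ℕ.* r ≡ tripleExponent m ℕ.+ d ℕ.* d
  above m d zero    eq with refl ← trans eq (ℕₚ.+-identityʳ d) = lemma m
    where
    lemma : ∀ m → suc (m ℕ.+ suc m) ℕ.* (m ℕ.+ suc m) ℕ.+ suc (2 ℕ.* m) ℕ.* 0 ≡
                  (suc m ℕ.* m ℕ.+ suc (2 ℕ.* m) ℕ.* suc m) ℕ.+ suc m ℕ.* suc m
    lemma = ℕ-Solver.solve-∀
  above m d (suc r) eq with refl ← ℕₚ.suc-injective (trans eq (ℕₚ.+-suc d r)) = lemma d r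
    where
    lemma : ∀ d r → suc (d ℕ.+ r ℕ.+ d) ℕ.* (d ℕ.+ r ℕ.+ d) ℕ.+ suc (2 ℕ.* (d ℕ.+ r)) ℕ.* suc r ≡
                    (suc (d ℕ.+ r) ℕ.* (d ℕ.+ r) ℕ.+ suc (2 ℕ.* (d ℕ.+ r)) ℕ.* suc (d ℕ.+ r)) ℕ.+ d ℕ.* d
    lemma = ℕ-Solver.solve-∀

square-bound : ∀ d r → suc ((d ℕ.+ r) ℕ.+ (d ℕ.+ r)) ≤ d ℕ.* d ℕ.+ 2 ℕ.* suc r
square-bound zero    r = subst (suc (r ℕ.+ r) ≤_) (lemma r) (ℕₚ.n≤1+n (suc (r ℕ.+ r)))
  where
  lemma : ∀ r → 2 ℕ.+ (r ℕ.+ r) ≡ 0 ℕ.+ 2 ℕ.* (1 ℕ.+ r)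
  lemma = ℕ-Solver.solve-∀
square-bound (suc d) r = subst (suc ((suc d ℕ.+ r) ℕ.+ (suc d ℕ.+ r)) ≤_) (sym (lemma d r)) (ℕₚ.m≤n+m _ (d ℕ.* d))
  where
  lemma : ∀ d r → (1 ℕ.+ d) ℕ.* (1 ℕ.+ d) ℕ.+ 2 ℕ.* (1 ℕ.+ r) ≡
                  d ℕ.* d ℕ.+ (1 ℕ.+ ((1 ℕ.+ d ℕ.+ r) ℕ.+ (1 ℕ.+ d ℕ.+ r)))
  lemma = ℕ-Solver.solve-∀

truncation-bound : ∀ n k → k ≤ n ℕ.+ n →
                   suc (n ℕ.+ n) ≤ ∣ k - n ∣ ℕ.* ∣ k - n ∣ ℕ.+ 2 ℕ.* suc (n ∸ ∣ k - n ∣)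
truncation-bound n k k≤2n =
  subst (λ z → suc (z ℕ.+ z) ≤ ∣ k - n ∣ ℕ.* ∣ k - n ∣ ℕ.+ 2 ℕ.* suc (n ∸ ∣ k - n ∣))
        (ℕₚ.m+[n∸m]≡n (∣-∣≤ n k k≤2n)) (square-bound ∣ k - n ∣ (n ∸ ∣ k - n ∣))

offset-bounds : ∀ n k → k ≤ n ℕ.+ n →
                (n ∸ ∣ k - n ∣ ≤ k) × (n ∸ ∣ k - n ∣ ≤ (n ℕ.+ n) ∸ k) × (n ∸ ∣ k - n ∣ ≤ n)
offset-bounds n k k≤2n with ∣ k - n ∣ | ∣-∣-cases k n
... | d | inj₁ refl = ℕₚ.≤-reflexive (ℕₚ.m+n∸n≡m k d)
                    , ℕₚ.≤-trans (ℕₚ.≤-reflexive (ℕₚ.m+n∸n≡m k d)) (ℕₚ.≤-trans (ℕₚ.m≤m+n k (d ℕ.+ d)) (ℕₚ.≤-reflexive (sym (difference k d))))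
                    , ℕₚ.m∸n≤m (k ℕ.+ d) d
  where
  difference : ∀ k d → ((k ℕ.+ d) ℕ.+ (k ℕ.+ d)) ∸ k ≡ k ℕ.+ (d ℕ.+ d)
  difference k d = trans (cong (_∸ k) (regroup k d)) (ℕₚ.m+n∸m≡n k (k ℕ.+ (d ℕ.+ d)))
    where
    regroup : ∀ k d → (k ℕ.+ d) ℕ.+ (k ℕ.+ d) ≡ k ℕ.+ (k ℕ.+ (d ℕ.+ d))
    regroup = ℕ-Solver.solve-∀
... | d | inj₂ refl = ℕₚ.≤-trans (ℕₚ.m∸n≤m n d) (ℕₚ.m≤m+n n d)
                    , ℕₚ.≤-reflexive (sym (ℕₚ.[m+n]∸[m+o]≡n∸o n n d))
                    , ℕₚ.m∸n≤m n d

prodˢ-q^-2i : ∀ k → prodˢ k (λ i → q^ (2 ℕ.* i)) ≗ q^ (k ℕ.* pred k)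
prodˢ-q^-2i zero    = S.refl
prodˢ-q^-2i (suc k) = S.trans (*ˢ-cong (prodˢ-q^-2i k) S.refl)
  (S.trans (S.sym (q^-+ (k ℕ.* pred k) (2 ℕ.* k))) (q^-cong (k*pred-k+2k k)))

-𝟙-^ˢ : ∀ k → (-ˢ 𝟙) ^ˢ k ≗ const (sgn k)
-𝟙-^ˢ zero    = S.refl
-𝟙-^ˢ (suc k) = S.trans (*ˢ-cong (-𝟙-^ˢ k) S.refl)
  (S.trans (solve 1 (λ s → s :* (:- con (+ 1)) := :- s) (λ _ → refl) (const (sgn k))) -const)
  where
  -const : -ˢ const (sgn k) ≗ const (- sgn k)
  -const zero    = refl
  -const (suc n) = refl

q-q²-poch : ℕ → Series
q-q²-poch n = prodˢ n (λ i → 1-q^ (suc (2 ℕ.* i)))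

signedTheta : ℕ → Series
signedTheta n = sumˢ (suc (n ℕ.+ n)) (λ k → const (sgn k) *ˢ q^ (∣ k - n ∣ ℕ.* ∣ k - n ∣))

-- With x = q^(2m+1), y = -1 and N = 2n the q-binomial theorem reads, after cancelling q^tripleExponent,
-- (-1)ⁿ (q;q²)ₙ² = Σ_k (-1)ᵏ q^((k-n)²) [2n k].  Multiplying by (q²;q²)ₙ turns [2n k] into a series
-- ≡ 1 modulo q^(2(n-|k-n|)+2), and that modulus times q^((k-n)²) is divisible by q^(2n+1).
module TripleProduct (m : ℕ) where
  open ≗-Reasoning

  n : ℕ
  n = suc m

  x : Series
  x = q^ (suc (2 ℕ.* m))

  factor : ℕ → Series
  factor i = x +ˢ q^ (2 ℕ.* i) *ˢ (-ˢ 𝟙)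

  factor-low : ∀ i → i < n → factor i ≗ (-ˢ 𝟙 *ˢ q^ (2 ℕ.* i)) *ˢ 1-q^ (suc (2 ℕ.* (m ∸ i)))
  factor-low i (s≤s i≤m) = begin
    x +ˢ q^ (2 ℕ.* i) *ˢ (-ˢ 𝟙)
      ≈⟨ S.+-cong (S.trans (q^-cong exponent) (q^-+ (2 ℕ.* i) (suc (2 ℕ.* (m ∸ i))))) (S.refl {q^ (2 ℕ.* i) *ˢ (-ˢ 𝟙)}) ⟩
    q^ (2 ℕ.* i) *ˢ q^ (suc (2 ℕ.* (m ∸ i))) +ˢ q^ (2 ℕ.* i) *ˢ (-ˢ 𝟙)
      ≈⟨ solve 2 (λ a b → a :* b :+ a :* (:- con (+ 1)) := (:- con (+ 1) :* a) :* (con (+ 1) :+ :- b))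
               (λ _ → refl) (q^ (2 ℕ.* i)) (q^ (suc (2 ℕ.* (m ∸ i)))) ⟩
    (-ˢ 𝟙 *ˢ q^ (2 ℕ.* i)) *ˢ 1-q^ (suc (2 ℕ.* (m ∸ i))) ∎
    where
    exponent : suc (2 ℕ.* m) ≡ 2 ℕ.* i ℕ.+ suc (2 ℕ.* (m ∸ i))
    exponent = trans (cong (λ z → suc (2 ℕ.* z)) (sym (ℕₚ.m+[n∸m]≡n i≤m)))
                     (trans (cong suc (ℕₚ.*-distribˡ-+ 2 i (m ∸ i))) (sym (ℕₚ.+-suc (2 ℕ.* i) (2 ℕ.* (m ∸ i)))))

  factor-high : ∀ i → factor (n ℕ.+ i) ≗ x *ˢ 1-q^ (suc (2 ℕ.* i))
  factor-high i = begin
    x +ˢ q^ (2 ℕ.* (n ℕ.+ i)) *ˢ (-ˢ 𝟙)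
      ≈⟨ S.+-cong (S.refl {x}) (*ˢ-cong (S.trans (q^-cong (exponent m i)) (q^-+ (suc (2 ℕ.* m)) (suc (2 ℕ.* i)))) S.refl) ⟩
    x +ˢ x *ˢ q^ (suc (2 ℕ.* i)) *ˢ (-ˢ 𝟙)
      ≈⟨ solve 2 (λ x b → x :+ x :* b :* (:- con (+ 1)) := x :* (con (+ 1) :+ :- b)) (λ _ → refl) x (q^ (suc (2 ℕ.* i))) ⟩
    x *ˢ 1-q^ (suc (2 ℕ.* i)) ∎
    where
    exponent : ∀ m i → 2 ℕ.* (suc m ℕ.+ i) ≡ suc (2 ℕ.* m) ℕ.+ suc (2 ℕ.* i)
    exponent = ℕ-Solver.solve-∀

  Q : Series
  Q = q-q²-poch n

  product-form : prodˢ (n ℕ.+ n) factor ≗ q^ (tripleExponent m) *ˢ (const (sgn n) *ˢ Q *ˢ Q)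
  product-form = begin
    prodˢ (n ℕ.+ n) factor
      ≈⟨ Πˢ.big-+ n n factor ⟩
    prodˢ n factor *ˢ prodˢ n (λ i → factor (n ℕ.+ i))
      ≈⟨ *ˢ-cong (Πˢ.big-cong n factor-low) (Πˢ.big-cong n (λ i _ → factor-high i)) ⟩
    prodˢ n (λ i → (-ˢ 𝟙 *ˢ q^ (2 ℕ.* i)) *ˢ 1-q^ (suc (2 ℕ.* (m ∸ i)))) *ˢ prodˢ n (λ i → x *ˢ 1-q^ (suc (2 ℕ.* i)))
      ≈⟨ *ˢ-cong (Πˢ.big-∙ n (λ i → -ˢ 𝟙 *ˢ q^ (2 ℕ.* i)) (λ i → 1-q^ (suc (2 ℕ.* (m ∸ i)))))
                 (Πˢ.big-∙ n (λ _ → x) (λ i → 1-q^ (suc (2 ℕ.* i)))) ⟩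
    (prodˢ n (λ i → -ˢ 𝟙 *ˢ q^ (2 ℕ.* i)) *ˢ prodˢ n (λ i → 1-q^ (suc (2 ℕ.* (m ∸ i))))) *ˢ (x ^ˢ n *ˢ Q)
      ≈⟨ *ˢ-cong (*ˢ-cong (Πˢ.big-∙ n (λ _ → -ˢ 𝟙) (λ i → q^ (2 ℕ.* i)))
                          (Πˢ.big-reverse n (λ j → 1-q^ (suc (2 ℕ.* j)))))
                 (*ˢ-cong (q^-^ˢ (suc (2 ℕ.* m)) n) (S.refl {Q})) ⟩
    (((-ˢ 𝟙) ^ˢ n *ˢ prodˢ n (λ i → q^ (2 ℕ.* i))) *ˢ Q) *ˢ (q^ (suc (2 ℕ.* m) ℕ.* n) *ˢ Q)
      ≈⟨ *ˢ-cong (*ˢ-cong (*ˢ-cong (-𝟙-^ˢ n) (prodˢ-q^-2i n)) (S.refl {Q})) (S.refl {q^ (suc (2 ℕ.* m) ℕ.* n) *ˢ Q}) ⟩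
    ((const (sgn n) *ˢ q^ (n ℕ.* m)) *ˢ Q) *ˢ (q^ (suc (2 ℕ.* m) ℕ.* n) *ˢ Q)
      ≈⟨ solve 4 (λ c a b Q → ((c :* a) :* Q) :* (b :* Q) := (a :* b) :* (c :* Q :* Q))
               (λ _ → refl) (const (sgn n)) (q^ (n ℕ.* m)) (q^ (suc (2 ℕ.* m) ℕ.* n)) Q ⟩
    (q^ (n ℕ.* m) *ˢ q^ (suc (2 ℕ.* m) ℕ.* n)) *ˢ (const (sgn n) *ˢ Q *ˢ Q)
      ≈⟨ *ˢ-cong (S.sym (q^-+ (n ℕ.* m) (suc (2 ℕ.* m) ℕ.* n))) (S.refl {const (sgn n) *ˢ Q *ˢ Q}) ⟩
    q^ (tripleExponent m) *ˢ (const (sgn n) *ˢ Q *ˢ Q) ∎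

  term-form : ∀ k → k ≤ n ℕ.+ n → cauchyTerm (n ℕ.+ n) x (-ˢ 𝟙) k ≗
              q^ (tripleExponent m) *ˢ (const (sgn k) *ˢ q^ (∣ k - n ∣ ℕ.* ∣ k - n ∣) *ˢ qBinom (n ℕ.+ n) k)
  term-form k k≤2n = begin
    B *ˢ (q^ (k ℕ.* pred k) *ˢ (x ^ˢ (n ℕ.+ n ∸ k) *ˢ (-ˢ 𝟙) ^ˢ k))
      ≈⟨ *ˢ-cong (S.refl {B}) (*ˢ-cong (S.refl {q^ (k ℕ.* pred k)}) (*ˢ-cong (q^-^ˢ (suc (2 ℕ.* m)) (n ℕ.+ n ∸ k)) (-𝟙-^ˢ k))) ⟩
    B *ˢ (q^ (k ℕ.* pred k) *ˢ (q^ (suc (2 ℕ.* m) ℕ.* (n ℕ.+ n ∸ k)) *ˢ const (sgn k)))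
      ≈⟨ solve 4 (λ B a b c → B :* (a :* (b :* c)) := (a :* b) :* (c :* B))
               (λ _ → refl) B (q^ (k ℕ.* pred k)) (q^ (suc (2 ℕ.* m) ℕ.* (n ℕ.+ n ∸ k))) (const (sgn k)) ⟩
    (q^ (k ℕ.* pred k) *ˢ q^ (suc (2 ℕ.* m) ℕ.* (n ℕ.+ n ∸ k))) *ˢ (const (sgn k) *ˢ B)
      ≈⟨ *ˢ-cong exponents (S.refl {const (sgn k) *ˢ B}) ⟩
    (q^ (tripleExponent m) *ˢ q^ d²) *ˢ (const (sgn k) *ˢ B)
      ≈⟨ solve 4 (λ E d c B → (E :* d) :* (c :* B) := E :* (c :* d :* B))
               (λ _ → refl) (q^ (tripleExponent m)) (q^ d²) (const (sgn k)) B ⟩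
    q^ (tripleExponent m) *ˢ (const (sgn k) *ˢ q^ d² *ˢ B) ∎
    where
    B : Series
    B = qBinom (n ℕ.+ n) k
    d² : ℕ
    d² = ∣ k - n ∣ ℕ.* ∣ k - n ∣
    exponents : q^ (k ℕ.* pred k) *ˢ q^ (suc (2 ℕ.* m) ℕ.* (n ℕ.+ n ∸ k)) ≗ q^ (tripleExponent m) *ˢ q^ d²
    exponents = S.trans (S.sym (q^-+ (k ℕ.* pred k) (suc (2 ℕ.* m) ℕ.* (n ℕ.+ n ∸ k))))
                  (S.trans (q^-cong (exponent-shift m k k≤2n)) (q^-+ (tripleExponent m) d²))

  signed-identity : const (sgn n) *ˢ Q *ˢ Q ≗
                    sumˢ (suc (n ℕ.+ n)) (λ k → const (sgn k) *ˢ q^ (∣ k - n ∣ ℕ.* ∣ k - n ∣) *ˢ qBinom (n ℕ.+ n) k)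
  signed-identity = q^-*ˢ-cancel (tripleExponent m) (begin
    q^ (tripleExponent m) *ˢ (const (sgn n) *ˢ Q *ˢ Q)
      ≈⟨ product-form ⟨
    prodˢ (n ℕ.+ n) factor
      ≈⟨ cauchy-binomial (n ℕ.+ n) x (-ˢ 𝟙) ⟩
    sumˢ (suc (n ℕ.+ n)) (cauchyTerm (n ℕ.+ n) x (-ˢ 𝟙))
      ≈⟨ Σˢ.big-cong (suc (n ℕ.+ n)) (λ k k<2n+1 → term-form k (ℕₚ.≤-pred k<2n+1)) ⟩
    sumˢ (suc (n ℕ.+ n)) (λ k → q^ (tripleExponent m) *ˢ _)
      ≈⟨ *ˢ-sumˢ (suc (n ℕ.+ n)) (q^ (tripleExponent m)) _ ⟨
    q^ (tripleExponent m) *ˢ sumˢ (suc (n ℕ.+ n)) _ ∎)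

  term-below : ∀ k → k ≤ n ℕ.+ n →
    const (sgn k) *ˢ q^ (∣ k - n ∣ ℕ.* ∣ k - n ∣) *ˢ (qBinom (n ℕ.+ n) k *ˢ q²-poch n)
      ≈[ suc (n ℕ.+ n) ] const (sgn k) *ˢ q^ (∣ k - n ∣ ℕ.* ∣ k - n ∣)
  term-below k k≤2n with offset-bounds n k k≤2n
  ... | L≤k , L≤2n-k , L≤n =
    ≈[]-trans (≗⇒≈[] (S.*-assoc (const (sgn k)) (q^ d²) (qBinom (n ℕ.+ n) k *ˢ q²-poch n)))
    (*ˢ-cong-below (λ i _ → refl)
      (≈[]-trans (≈[]-weaken (truncation-bound n k k≤2n)
                   (q^-*ˢ-cong-below d² (qBinom-*ˢ-q²-poch-below-𝟙 (n ℕ.+ n) k n (n ∸ ∣ k - n ∣) k≤2n L≤k L≤2n-k L≤n)))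
                 (≗⇒≈[] (S.*-identityʳ (q^ d²)))))
    where
    d² : ℕ
    d² = ∣ k - n ∣ ℕ.* ∣ k - n ∣

  jacobi-below : Q *ˢ Q *ˢ q²-poch n ≈[ suc (n ℕ.+ n) ] const (sgn n) *ˢ signedTheta n
  jacobi-below =
    ≈[]-trans (≗⇒≈[] sign-twice)
    (*ˢ-cong-below (λ i _ → refl)
      (≈[]-trans (≗⇒≈[] expand) (sumˢ-cong-below (suc (n ℕ.+ n)) (λ k k<2n+1 → term-below k (ℕₚ.≤-pred k<2n+1)))))
    where
    c : Series
    c = const (sgn n)
    sign-twice : Q *ˢ Q *ˢ q²-poch n ≗ c *ˢ (c *ˢ Q *ˢ Q *ˢ q²-poch n)
    sign-twice = S.trans (S.sym (*ˢ-identityˡ (Q *ˢ Q *ˢ q²-poch n)))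
      (S.trans (*ˢ-cong (S.trans (λ i → cong (λ s → const s i) (sym (sgn-*-sgn n))) (const-*-homo (sgn n) (sgn n))) S.refl)
        (solve 4 (λ c a b p → (c :* c) :* (a :* b :* p) := c :* (c :* a :* b :* p)) (λ _ → refl) c Q Q (q²-poch n)))
    expand : c *ˢ Q *ˢ Q *ˢ q²-poch n ≗
             sumˢ (suc (n ℕ.+ n)) (λ k → const (sgn k) *ˢ q^ (∣ k - n ∣ ℕ.* ∣ k - n ∣) *ˢ (qBinom (n ℕ.+ n) k *ˢ q²-poch n))
    expand = S.trans (*ˢ-cong signed-identity (S.refl {q²-poch n}))
      (S.trans (sumˢ-*ˢ (suc (n ℕ.+ n)) _ (q²-poch n)) (Σˢ.big-cong (suc (n ℕ.+ n)) (λ k _ → S.*-assoc _ _ (q²-poch n))))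

thetaUpTo : ℕ → Series
thetaUpTo R = sumˢ (suc R) (λ j → q^ (j ℕ.* j)) +ˢ sumˢ R (λ i → q^ (suc i ℕ.* suc i))

signedTheta-alt : ∀ n → const (sgn n) *ˢ signedTheta n ≗ alt (thetaUpTo n)
signedTheta-alt n = begin
  const (sgn n) *ˢ signedTheta n
    ≈⟨ *ˢ-sumˢ (suc (n ℕ.+ n)) (const (sgn n)) term ⟩
  sumˢ (suc (n ℕ.+ n)) F
    ≡⟨ cong (λ N → sumˢ N F) (sym (ℕₚ.+-suc n n)) ⟩
  sumˢ (n ℕ.+ suc n) F
    ≈⟨ Σˢ.big-+ n (suc n) F ⟩
  sumˢ n F +ˢ sumˢ (suc n) (λ j → F (n ℕ.+ j))
    ≈⟨ S.+-cong (S.sym (Σˢ.big-reverse n F)) S.refl ⟩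
  sumˢ n (λ i → F (n ∸ suc i)) +ˢ sumˢ (suc n) (λ j → F (n ℕ.+ j))
    ≈⟨ S.+-cong (Σˢ.big-cong n low) (Σˢ.big-cong (suc n) (λ j _ → high j)) ⟩
  sumˢ n (λ i → alt (q^ (suc i ℕ.* suc i))) +ˢ sumˢ (suc n) (λ j → alt (q^ (j ℕ.* j)))
    ≈⟨ S.+-comm (sumˢ n (λ i → alt (q^ (suc i ℕ.* suc i)))) (sumˢ (suc n) (λ j → alt (q^ (j ℕ.* j)))) ⟩
  sumˢ (suc n) (λ j → alt (q^ (j ℕ.* j))) +ˢ sumˢ n (λ i → alt (q^ (suc i ℕ.* suc i)))
    ≈⟨ S.+-cong (alt-sumˢ (suc n) (λ j → q^ (j ℕ.* j))) (alt-sumˢ n (λ i → q^ (suc i ℕ.* suc i))) ⟨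
  alt (sumˢ (suc n) (λ j → q^ (j ℕ.* j))) +ˢ alt (sumˢ n (λ i → q^ (suc i ℕ.* suc i)))
    ≈⟨ alt-+ˢ (sumˢ (suc n) (λ j → q^ (j ℕ.* j))) (sumˢ n (λ i → q^ (suc i ℕ.* suc i))) ⟨
  alt (thetaUpTo n) ∎
  where
  open ≗-Reasoning
  term F : ℕ → Series
  term k = const (sgn k) *ˢ q^ (∣ k - n ∣ ℕ.* ∣ k - n ∣)
  F k = const (sgn n) *ˢ term k

  F-alt : ∀ k d → sgn n * sgn k ≡ sgn d → ∣ k - n ∣ ≡ d → F k ≗ alt (q^ (d ℕ.* d))
  F-alt k d sign dist = begin
    const (sgn n) *ˢ (const (sgn k) *ˢ q^ (∣ k - n ∣ ℕ.* ∣ k - n ∣))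
      ≈⟨ S.sym (S.*-assoc _ _ _) ⟩
    const (sgn n) *ˢ const (sgn k) *ˢ q^ (∣ k - n ∣ ℕ.* ∣ k - n ∣)
      ≈⟨ *ˢ-cong (S.sym (const-*-homo (sgn n) (sgn k))) (q^-cong (cong (λ z → z ℕ.* z) dist)) ⟩
    const (sgn n * sgn k) *ˢ q^ (d ℕ.* d)
      ≈⟨ const-*ˢ (sgn n * sgn k) (q^ (d ℕ.* d)) ⟩
    (sgn n * sgn k) · q^ (d ℕ.* d)
      ≡⟨ cong (_· q^ (d ℕ.* d)) (trans sign (sym (sgn-square d))) ⟩
    sgn (d ℕ.* d) · q^ (d ℕ.* d)
      ≈⟨ alt-q^ (d ℕ.* d) ⟨
    alt (q^ (d ℕ.* d)) ∎

  high : ∀ j → F (n ℕ.+ j) ≗ alt (q^ (j ℕ.* j))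
  high j = F-alt (n ℕ.+ j) j (sgn-*-sgn-+ n j) (trans (ℕₚ.∣-∣-comm (n ℕ.+ j) n) (ℕₚ.∣m-m+n∣≡n n j))

  low : ∀ i → i < n → F (n ∸ suc i) ≗ alt (q^ (suc i ℕ.* suc i))
  low i i<n = F-alt k (suc i) sign distance
    where
    k : ℕ
    k = n ∸ suc i
    n≡k+i+1 : n ≡ k ℕ.+ suc i
    n≡k+i+1 = sym (ℕₚ.m∸n+n≡m i<n)
    sign : sgn n * sgn k ≡ sgn (suc i)
    sign = trans (cong (λ z → sgn z * sgn k) n≡k+i+1)
                 (trans (ℤₚ.*-comm (sgn (k ℕ.+ suc i)) (sgn k)) (sgn-*-sgn-+ k (suc i)))
    distance : ∣ k - n ∣ ≡ suc i
    distance = trans (cong (λ z → ∣ k - z ∣) n≡k+i+1) (ℕₚ.∣m-m+n∣≡n k (suc i))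

-- Logarithmic derivative of the product side

-- a qᵃ / (1 - qᵃ)
lambert : ℕ → Series
lambert a zero    = + 0
lambert a (suc j) = if does (a ∣? suc j) then + a else + 0

lambert-coeff-< : ∀ a j → j < a → lambert a j ≡ + 0
lambert-coeff-< a zero    _   = refl
lambert-coeff-< a (suc j) j<a =
  cong (λ b → if b then + a else + 0) (dec-false (a ∣? suc j) (λ a∣j → ℕₚ.<⇒≱ j<a (∣⇒≤ a∣j)))

lambert-coeff-self : ∀ a → lambert (suc a) (suc a ℕ.+ 0) ≡ + suc a
lambert-coeff-self a =
  cong (λ b → if b then + suc a else + 0)
       (dec-true (suc a ∣? (suc a ℕ.+ 0)) (divides 1 (trans (ℕₚ.+-identityʳ (suc a)) (sym (ℕₚ.*-identityˡ (suc a))))))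

lambert-coeff-+ : ∀ a t → lambert (suc a) (suc a ℕ.+ suc t) ≡ lambert (suc a) (suc t)
lambert-coeff-+ a t = cong (λ b → if b then + suc a else + 0)
  (sym (does-⇔ (mk⇔ (∣m∣n⇒∣m+n ∣-refl) (λ a∣a+t → ∣m+n∣m⇒∣n a∣a+t ∣-refl)) (suc a ∣? suc t) (suc a ∣? (suc a ℕ.+ suc t))))

lambert-*ˢ-1-q^ : ∀ a → lambert (suc a) *ˢ 1-q^ (suc a) ≗ + suc a · q^ (suc a)
lambert-*ˢ-1-q^ a = S.trans expand (≗-split-at A low high)
  where
  A : ℕ
  A = suc a
  L : Series
  L = lambert A
  expand : L *ˢ 1-q^ A ≗ L +ˢ -ˢ shift A L
  expand = S.trans (solve 2 (λ L x → L :* (con (+ 1) :+ :- x) := L :+ :- (x :* L)) (λ _ → refl) L (q^ A))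
                   (S.+-cong (S.refl {L}) (S.-‿cong (q^-*ˢ A L)))
  low : ∀ i → i < A → L i + - shift A L i ≡ + A * (q^ A) i
  low i i<A rewrite lambert-coeff-< A i i<A | shift-coeff-< A L i i<A | q^-coeff-< A i i<A =
    sym (ℤₚ.*-zeroʳ (+ A))
  high : ∀ t → L (A ℕ.+ t) + - shift A L (A ℕ.+ t) ≡ + A * (q^ A) (A ℕ.+ t)
  high t rewrite shift-coeff-+ A L t | q^-coeff-+ A t = high′ t
    where
    high′ : ∀ t → L (A ℕ.+ t) + - L t ≡ + A * 𝟙 t
    high′ zero    = trans (cong (_+ + 0) (lambert-coeff-self a)) (trans (ℤₚ.+-identityʳ (+ A)) (sym (ℤₚ.*-identityʳ (+ A))))
    high′ (suc t) = trans (cong (_+ - L (suc t)) (lambert-coeff-+ a t))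
                          (trans (ℤₚ.+-inverseʳ (L (suc t))) (sym (ℤₚ.*-zeroʳ (+ A))))

NegLogDeriv-1-q^ : ∀ a → NegLogDeriv (1-q^ (suc a)) (lambert (suc a))
NegLogDeriv-1-q^ a j = begin
  + j * (𝟙 j + - (q^ A) j)          ≡⟨ ℤₚ.*-distribˡ-+ (+ j) (𝟙 j) (- (q^ A) j) ⟩
  D 𝟙 j + + j * - (q^ A) j          ≡⟨ cong₂ _+_ (D-𝟙 j) (sym (ℤₚ.neg-distribʳ-* (+ j) ((q^ A) j))) ⟩
  + 0 + - D (q^ A) j                ≡⟨ ℤₚ.+-identityˡ _ ⟩
  - D (q^ A) j                      ≡⟨ cong -_ (D-q^ A j) ⟩
  - (+ A * (q^ A) j)                ≡⟨ cong -_ (lambert-*ˢ-1-q^ a j) ⟨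
  - (lambert A *ˢ 1-q^ A) j         ∎
  where
  open ≡-Reasoning
  A : ℕ
  A = suc a

listΣ : (ℕ → ℤ) → List ℕ → ℤ
listΣ g []       = + 0
listΣ g (x ∷ xs) = g x + listΣ g xs

sum-listΣ : ∀ xs → + sum xs ≡ listΣ +_ xs
sum-listΣ []       = refl
sum-listΣ (x ∷ xs) = trans (ℤₚ.pos-+ x (sum xs)) (cong (_+_ (+ x)) (sum-listΣ xs))

listΣ-filter : ∀ {P : Pred ℕ 0ℓ} (P? : Decidable P) g xs →
               listΣ g (filter P? xs) ≡ listΣ (λ x → if does (P? x) then g x else + 0) xs
listΣ-filter P? g []       = refl
listΣ-filter P? g (x ∷ xs) with does (P? x)
... | true  = cong (_+_ (g x)) (listΣ-filter P? g xs)
... | false = trans (listΣ-filter P? g xs) (sym (ℤₚ.+-identityˡ _))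

listΣ-applyUpTo : ∀ g f M → listΣ g (applyUpTo f M) ≡ Σℤ.big M (g ∘ f)
listΣ-applyUpTo g f zero    = refl
listΣ-applyUpTo g f (suc M) =
  trans (cong (_+_ (g (f 0))) (listΣ-applyUpTo g (f ∘ suc) M)) (sym (Σℤ.big-suc M (g ∘ f)))

map-suc-upTo : ∀ n → map suc (upTo n) ≡ applyUpTo suc n
map-suc-upTo = List.map-applyUpTo (λ x → x) suc

if-swap : ∀ b c (z : ℤ) → (if b then (if c then z else + 0) else + 0) ≡ (if c then (if b then z else + 0) else + 0)
if-swap false false z = refl
if-swap false true  z = refl
if-swap true  false z = refl
if-swap true  true  z = refl

if-+0 : ∀ b → (if b then + 0 else + 0) ≡ + 0
if-+0 false = refl
if-+0 true  = refl

oddLambert : ℕ → Series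
oddLambert a j = if does (¬? (2 ∣? a)) then lambert a j else + 0

2∤1+2i : ∀ i → ¬ (2 ∣ suc (2 ℕ.* i))
2∤1+2i i (divides q 1+2i≡q*2) = ℕₚ.even≢odd q i (trans (ℕₚ.*-comm 2 q) (sym 1+2i≡q*2))

2∣2+2i : ∀ i → 2 ∣ suc (suc (2 ℕ.* i))
2∣2+2i i = divides (suc i) (trans (sym (ℕₚ.*-suc 2 i)) (ℕₚ.*-comm 2 (suc i)))

oddLambert-odd : ∀ i → oddLambert (suc (2 ℕ.* i)) ≗ lambert (suc (2 ℕ.* i))
oddLambert-odd i j =
  cong (λ b → if b then lambert (suc (2 ℕ.* i)) j else + 0) (dec-true (¬? (2 ∣? suc (2 ℕ.* i))) (2∤1+2i i))

oddLambert-even : ∀ i → oddLambert (suc (suc (2 ℕ.* i))) ≗ 𝟘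
oddLambert-even i j = cong (λ b → if b then lambert (suc (suc (2 ℕ.* i))) j else + 0)
  (dec-false (¬? (2 ∣? suc (suc (2 ℕ.* i)))) (λ 2∤ → 2∤ (2∣2+2i i)))

σ-lambert : ∀ j M → suc j ≤ M → + σ (suc j) ≡ Σℤ.big M (λ a → lambert (suc a) (suc j))
σ-lambert j M j<M = begin
  + sum (filter (_∣? suc j) (map suc (upTo (suc j))))
    ≡⟨ cong (λ xs → + sum (filter (_∣? suc j) xs)) (map-suc-upTo (suc j)) ⟩
  + sum (filter (_∣? suc j) (applyUpTo suc (suc j)))
    ≡⟨ sum-listΣ (filter (_∣? suc j) (applyUpTo suc (suc j))) ⟩
  listΣ +_ (filter (_∣? suc j) (applyUpTo suc (suc j)))
    ≡⟨ listΣ-filter (_∣? suc j) +_ (applyUpTo suc (suc j)) ⟩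
  listΣ (λ x → if does (x ∣? suc j) then + x else + 0) (applyUpTo suc (suc j))
    ≡⟨ listΣ-applyUpTo (λ x → if does (x ∣? suc j) then + x else + 0) suc (suc j) ⟩
  Σℤ.big (suc j) (λ a → lambert (suc a) (suc j))
    ≡⟨ Σℤ.big-extend (suc j) (M ∸ suc j) (λ a → lambert (suc a) (suc j))
                     (λ k → lambert-coeff-< (suc (suc j ℕ.+ k)) (suc j) (s≤s (ℕₚ.m≤m+n (suc j) k))) ⟨
  Σℤ.big (suc j ℕ.+ (M ∸ suc j)) (λ a → lambert (suc a) (suc j))
    ≡⟨ cong (λ N → Σℤ.big N (λ a → lambert (suc a) (suc j))) (ℕₚ.m+[n∸m]≡n j<M) ⟩
  Σℤ.big M (λ a → lambert (suc a) (suc j)) ∎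
  where open ≡-Reasoning

σₒ-lambert : ∀ j M → suc j ≤ M → + σₒ (suc j) ≡ Σℤ.big M (λ a → oddLambert (suc a) (suc j))
σₒ-lambert j M j<M = begin
  + sum (filter (λ d → ¬? (2 ∣? d)) (filter (_∣? suc j) (map suc (upTo (suc j)))))
    ≡⟨ cong (λ xs → + sum (filter (λ d → ¬? (2 ∣? d)) (filter (_∣? suc j) xs))) (map-suc-upTo (suc j)) ⟩
  + sum (filter (λ d → ¬? (2 ∣? d)) (filter (_∣? suc j) (applyUpTo suc (suc j))))
    ≡⟨ sum-listΣ (filter (λ d → ¬? (2 ∣? d)) (filter (_∣? suc j) (applyUpTo suc (suc j)))) ⟩
  listΣ +_ (filter (λ d → ¬? (2 ∣? d)) (filter (_∣? suc j) (applyUpTo suc (suc j))))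
    ≡⟨ listΣ-filter (λ d → ¬? (2 ∣? d)) +_ (filter (_∣? suc j) (applyUpTo suc (suc j))) ⟩
  listΣ (λ x → if does (¬? (2 ∣? x)) then + x else + 0) (filter (_∣? suc j) (applyUpTo suc (suc j)))
    ≡⟨ listΣ-filter (_∣? suc j) (λ x → if does (¬? (2 ∣? x)) then + x else + 0) (applyUpTo suc (suc j)) ⟩
  listΣ (λ x → if does (x ∣? suc j) then (if does (¬? (2 ∣? x)) then + x else + 0) else + 0) (applyUpTo suc (suc j))
    ≡⟨ listΣ-applyUpTo (λ x → if does (x ∣? suc j) then (if does (¬? (2 ∣? x)) then + x else + 0) else + 0) suc (suc j) ⟩
  Σℤ.big (suc j) (λ a → if does (suc a ∣? suc j) then (if does (¬? (2 ∣? suc a)) then + suc a else + 0) else + 0)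
    ≡⟨ Σℤ.big-cong (suc j) (λ a _ → if-swap (does (suc a ∣? suc j)) (does (¬? (2 ∣? suc a))) (+ suc a)) ⟩
  Σℤ.big (suc j) (λ a → oddLambert (suc a) (suc j))
    ≡⟨ Σℤ.big-extend (suc j) (M ∸ suc j) (λ a → oddLambert (suc a) (suc j)) vanish ⟨
  Σℤ.big (suc j ℕ.+ (M ∸ suc j)) (λ a → oddLambert (suc a) (suc j))
    ≡⟨ cong (λ N → Σℤ.big N (λ a → oddLambert (suc a) (suc j))) (ℕₚ.m+[n∸m]≡n j<M) ⟩
  Σℤ.big M (λ a → oddLambert (suc a) (suc j)) ∎
  where
  open ≡-Reasoning
  vanish : ∀ k → oddLambert (suc (suc j ℕ.+ k)) (suc j) ≡ + 0
  vanish k = trans (cong (λ z → if does (¬? (2 ∣? suc (suc j ℕ.+ k))) then z else + 0)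
                         (lambert-coeff-< (suc (suc j ℕ.+ k)) (suc j) (s≤s (ℕₚ.m≤m+n (suc j) k))))
                   (if-+0 _)

σ+σₒ : Series
σ+σₒ j = + σ j + + σₒ j

lambertSum : ℕ → Series
lambertSum n = sumˢ n (λ i → lambert (suc (2 ℕ.* i))) +ˢ sumˢ n (λ i → lambert (suc (2 ℕ.* i)))
            +ˢ sumˢ n (λ i → lambert (2 ℕ.* suc i))

lambertSum-below : ∀ n → lambertSum n ≈[ suc (n ℕ.+ n) ] σ+σₒ
lambertSum-below n zero    _ =
  cong₂ _+_ (cong₂ _+_ (vanish (λ i → suc (2 ℕ.* i))) (vanish (λ i → suc (2 ℕ.* i)))) (vanish (λ i → 2 ℕ.* suc i))
  where
  vanish : ∀ f → sumˢ n (λ i → lambert (f i)) 0 ≡ + 0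
  vanish f = trans (sumˢ-coeff n (λ i → lambert (f i)) 0) (Σℤ.big-ε n)
lambertSum-below n (suc j) (s≤s j<2n) = begin
  sumˢ n Odd (suc j) + sumˢ n Odd (suc j) + sumˢ n Even (suc j)
    ≡⟨ cong₂ _+_ (cong₂ _+_ (sumˢ-coeff n Odd (suc j)) (sumˢ-coeff n Odd (suc j))) (sumˢ-coeff n Even (suc j)) ⟩
  O + O + E
    ≡⟨ ℤₚ.+-assoc O O E ⟩
  O + (O + E)
    ≡⟨ cong₂ _+_ odd-part (sym (Σℤ.big-interleave n (λ a → lambert (suc a) (suc j)) ⟨ trans ⟩ even-part)) ⟩
  Σℤ.big (n ℕ.+ n) (λ a → oddLambert (suc a) (suc j)) + Σℤ.big (n ℕ.+ n) (λ a → lambert (suc a) (suc j))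
    ≡⟨ cong₂ _+_ (σₒ-lambert j (n ℕ.+ n) j<2n) (σ-lambert j (n ℕ.+ n) j<2n) ⟨
  + σₒ (suc j) + + σ (suc j)
    ≡⟨ ℤₚ.+-comm (+ σₒ (suc j)) (+ σ (suc j)) ⟩
  σ+σₒ (suc j) ∎
  where
  open ≡-Reasoning
  Odd Even : ℕ → Series
  Odd i = lambert (suc (2 ℕ.* i))
  Even i = lambert (2 ℕ.* suc i)
  O E : ℤ
  O = Σℤ.big n (λ i → Odd i (suc j))
  E = Σℤ.big n (λ i → Even i (suc j))
  even-part : O + Σℤ.big n (λ i → lambert (suc (suc (2 ℕ.* i))) (suc j)) ≡ O + E
  even-part = cong (_+_ O) (Σℤ.big-cong n (λ i _ → cong (λ a → lambert a (suc j)) (sym (ℕₚ.*-suc 2 i))))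
  odd-part : O ≡ Σℤ.big (n ℕ.+ n) (λ a → oddLambert (suc a) (suc j))
  odd-part = sym (begin
    Σℤ.big (n ℕ.+ n) (λ a → oddLambert (suc a) (suc j))
      ≡⟨ Σℤ.big-interleave n (λ a → oddLambert (suc a) (suc j)) ⟩
    Σℤ.big n (λ i → oddLambert (suc (2 ℕ.* i)) (suc j)) + Σℤ.big n (λ i → oddLambert (suc (suc (2 ℕ.* i))) (suc j))
      ≡⟨ cong₂ _+_ (Σℤ.big-cong n (λ i _ → oddLambert-odd i (suc j)))
                   (trans (Σℤ.big-cong n (λ i _ → oddLambert-even i (suc j))) (Σℤ.big-ε n)) ⟩
    O + + 0
      ≡⟨ ℤₚ.+-identityʳ O ⟩
    O ∎)

NegLogDeriv-Jacobi : ∀ n → NegLogDeriv (q-q²-poch n *ˢ q-q²-poch n *ˢ q²-poch n) (lambertSum n)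
NegLogDeriv-Jacobi n = NegLogDeriv-*ˢ (NegLogDeriv-*ˢ odd odd) (NegLogDeriv-prodˢ n (λ i → NegLogDeriv-1-q^ _))
  where
  odd : NegLogDeriv (q-q²-poch n) (sumˢ n (λ i → lambert (suc (2 ℕ.* i))))
  odd = NegLogDeriv-prodˢ n (λ i → NegLogDeriv-1-q^ (2 ℕ.* i))

-- Sums of squares

∣_∣² : ℤ → ℕ
∣ x ∣² = ℤ.∣ x ∣ ℕ.* ℤ.∣ x ∣

x*x≡∣x∣² : ∀ x → x * x ≡ + ∣ x ∣²
x*x≡∣x∣² (+ n)      = sym (ℤₚ.pos-* n n)
x*x≡∣x∣² (ℤ.-[1+ n ]) = refl

sumSqℕ : ∀ {k} → Vec ℤ k → ℕ
sumSqℕ []       = 0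
sumSqℕ (x ∷ v) = ∣ x ∣² ℕ.+ sumSqℕ v

sumSq≡sumSqℕ : ∀ {k} (v : Vec ℤ k) → sumSq v ≡ + sumSqℕ v
sumSq≡sumSqℕ []      = refl
sumSq≡sumSqℕ (x ∷ v) = trans (cong₂ _+_ (x*x≡∣x∣² x) (sumSq≡sumSqℕ v)) (sym (ℤₚ.pos-+ ∣ x ∣² (sumSqℕ v)))

countSumSq : ∀ {k} → List (Vec ℤ k) → Series
countSumSq vs n = + length (filter (λ v → sumSq v ℤ.≟ + n) vs)

length-filter-map : ∀ {A B : Set} {P : Pred B 0ℓ} (P? : Decidable P) (f : A → B) xs →
                    length (filter P? (map f xs)) ≡ length (filter (P? ∘ f) xs)
length-filter-map P? f []       = refl
length-filter-map P? f (x ∷ xs) with does (P? (f x))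
... | true  = cong suc (length-filter-map P? f xs)
... | false = length-filter-map P? f xs

countSumSq-cons : ∀ {k} x (vs : List (Vec ℤ k)) → countSumSq (map (x ∷_) vs) ≗ q^ ∣ x ∣² *ˢ countSumSq vs
countSumSq-cons {k} x vs = S.trans (λ n → cong +_ (length-filter-map (λ v → sumSq v ℤ.≟ + n) (x ∷_) vs))
  (S.trans (≗-split-at ∣ x ∣² low high) (S.sym (q^-*ˢ ∣ x ∣² (countSumSq vs))))
  where
  P? : ∀ n (v : Vec ℤ k) → Dec (x * x + sumSq v ≡ + n)
  P? n v = x * x + sumSq v ℤ.≟ + n
  x∷v : ∀ v → x * x + sumSq v ≡ + (∣ x ∣² ℕ.+ sumSqℕ v)
  x∷v v = trans (cong₂ _+_ (x*x≡∣x∣² x) (sumSq≡sumSqℕ v)) (sym (ℤₚ.pos-+ ∣ x ∣² (sumSqℕ v)))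

  low : ∀ n → n < ∣ x ∣² → + length (filter (P? n) vs) ≡ shift ∣ x ∣² (countSumSq vs) n
  low n n<x² = trans (cong (λ ws → + length ws) (List.filter-none (P? n) (All.universal too-big vs)))
                     (sym (shift-coeff-< ∣ x ∣² (countSumSq vs) n n<x²))
    where
    too-big : ∀ v → x * x + sumSq v ≢ + n
    too-big v eq = ℕₚ.<⇒≱ n<x² (subst (∣ x ∣² ≤_) (ℤₚ.+-injective (trans (sym (x∷v v)) eq))
                                                   (ℕₚ.m≤m+n ∣ x ∣² (sumSqℕ v)))

  high : ∀ t → + length (filter (P? (∣ x ∣² ℕ.+ t)) vs) ≡ shift ∣ x ∣² (countSumSq vs) (∣ x ∣² ℕ.+ t)
  high t = trans (cong (λ ws → + length ws) (List.filter-≐ (P? (∣ x ∣² ℕ.+ t)) (λ v → sumSq v ℤ.≟ + t) same vs))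
                 (sym (shift-coeff-+ ∣ x ∣² (countSumSq vs) t))
    where
    to : ∀ {v} → x * x + sumSq v ≡ + (∣ x ∣² ℕ.+ t) → sumSq v ≡ + t
    to {v} eq = trans (sumSq≡sumSqℕ v)
                      (cong +_ (ℕₚ.+-cancelˡ-≡ ∣ x ∣² (sumSqℕ v) t (ℤₚ.+-injective (trans (sym (x∷v v)) eq))))
    from : ∀ {v} → sumSq v ≡ + t → x * x + sumSq v ≡ + (∣ x ∣² ℕ.+ t)
    from {v} eq = trans (x∷v v) (cong (λ z → + (∣ x ∣² ℕ.+ z)) (ℤₚ.+-injective (trans (sym (sumSq≡sumSqℕ v)) eq)))
    same : (λ v → x * x + sumSq v ≡ + (∣ x ∣² ℕ.+ t)) ≐ (λ v → sumSq v ≡ + t)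
    same = (λ {v} → to {v}) , (λ {v} → from {v})

countSumSq-++ : ∀ {k} (us vs : List (Vec ℤ k)) → countSumSq (us ++ vs) ≗ countSumSq us +ˢ countSumSq vs
countSumSq-++ {k} us vs n = begin
  + length (filter P? (us ++ vs))                         ≡⟨ cong (λ ws → + length ws) (List.filter-++ P? us vs) ⟩
  + length (filter P? us ++ filter P? vs)                 ≡⟨ cong +_ (List.length-++ (filter P? us)) ⟩
  + (length (filter P? us) ℕ.+ length (filter P? vs))     ≡⟨ ℤₚ.pos-+ (length (filter P? us)) (length (filter P? vs)) ⟩
  countSumSq us n + countSumSq vs n                       ∎
  where
  open ≡-Reasoning
  P? : ∀ (v : Vec ℤ k) → Dec (sumSq v ≡ + n)
  P? v = sumSq v ℤ.≟ + n

squaresSeries : List ℤ → Series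
squaresSeries []       = 𝟘
squaresSeries (x ∷ xs) = q^ ∣ x ∣² +ˢ squaresSeries xs

countSumSq-concatMap : ∀ {k} xs (vs : List (Vec ℤ k)) →
                       countSumSq (concatMap (λ x → map (x ∷_) vs) xs) ≗ squaresSeries xs *ˢ countSumSq vs
countSumSq-concatMap []       vs = S.sym (*ˢ-zeroˡ (countSumSq vs))
countSumSq-concatMap (x ∷ xs) vs = S.trans (countSumSq-++ (map (x ∷_) vs) (concatMap (λ x → map (x ∷_) vs) xs))
  (S.trans (S.+-cong (countSumSq-cons x vs) (countSumSq-concatMap xs vs))
           (S.sym (*ˢ-distribʳ (q^ ∣ x ∣²) (squaresSeries xs) (countSumSq vs))))

countSumSq-boxVecs : ∀ k R → countSumSq (boxVecs k R) ≗ squaresSeries (range R) ^ˢ k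
countSumSq-boxVecs zero    R zero    = refl
countSumSq-boxVecs zero    R (suc n) = refl
countSumSq-boxVecs (suc k) R = S.trans (countSumSq-concatMap (range R) (boxVecs k R))
  (S.trans (*ˢ-cong (S.refl {squaresSeries (range R)}) (countSumSq-boxVecs k R))
           (*ˢ-comm (squaresSeries (range R)) (squaresSeries (range R) ^ˢ k)))

squaresSeries-++ : ∀ xs ys → squaresSeries (xs ++ ys) ≗ squaresSeries xs +ˢ squaresSeries ys
squaresSeries-++ []       ys n = sym (ℤₚ.+-identityˡ _)
squaresSeries-++ (x ∷ xs) ys n = trans (cong (_+_ ((q^ ∣ x ∣²) n)) (squaresSeries-++ xs ys n))
                                       (sym (ℤₚ.+-assoc ((q^ ∣ x ∣²) n) (squaresSeries xs n) (squaresSeries ys n)))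

squaresSeries-applyUpTo : ∀ f M → squaresSeries (applyUpTo f M) ≗ sumˢ M (λ i → q^ ∣ f i ∣²)
squaresSeries-applyUpTo f zero    = S.refl
squaresSeries-applyUpTo f (suc M) = S.trans (S.+-cong (S.refl {q^ ∣ f 0 ∣²}) (squaresSeries-applyUpTo (f ∘ suc) M))
                                            (S.sym (Σˢ.big-suc M (λ i → q^ ∣ f i ∣²)))

squaresSeries-range : ∀ R → squaresSeries (range R) ≗ thetaUpTo R
squaresSeries-range R = S.trans (squaresSeries-++ (map +_ (upTo (suc R))) (map (λ i → - (+ suc i)) (upTo R)))
  (S.+-cong (S.trans (λ n → cong (λ xs → squaresSeries xs n) (List.map-applyUpTo (λ i → i) +_ (suc R)))
                     (squaresSeries-applyUpTo +_ (suc R)))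
            (S.trans (λ n → cong (λ xs → squaresSeries xs n) (List.map-applyUpTo (λ i → i) (λ i → - (+ suc i)) R))
                     (squaresSeries-applyUpTo (λ i → - (+ suc i)) R)))

r-coeff : ∀ k j → + r k j ≡ (squaresSeries (range j) ^ˢ k) j
r-coeff k j = countSumSq-boxVecs k j j

q^-below-𝟘 : ∀ e K → K ≤ e → q^ e ≈[ K ] 𝟘
q^-below-𝟘 e K K≤e i i<K = q^-coeff-< e i (ℕₚ.<-≤-trans i<K K≤e)

sumˢ-extend-below : ∀ N d K F → (∀ i → F (N ℕ.+ i) ≈[ K ] 𝟘) → sumˢ (N ℕ.+ d) F ≈[ K ] sumˢ N F
sumˢ-extend-below N d K F F≈𝟘 =
  ≈[]-trans (≗⇒≈[] (Σˢ.big-+ N d F))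
  (≈[]-trans (+ˢ-cong-below (λ i _ → refl {x = sumˢ N F i})
                            (≈[]-trans (sumˢ-cong-below d (λ i _ → F≈𝟘 i)) (≗⇒≈[] (Σˢ.big-ε d))))
             (≗⇒≈[] (S.+-identityʳ (sumˢ N F))))

thetaUpTo-stable : ∀ R R′ → R ≤ R′ → thetaUpTo R′ ≈[ suc R ] thetaUpTo R
thetaUpTo-stable R R′ R≤R′ = subst (λ z → thetaUpTo z ≈[ suc R ] thetaUpTo R) (ℕₚ.m+[n∸m]≡n R≤R′)
  (+ˢ-cong-below (sumˢ-extend-below (suc R) d (suc R) (λ j → q^ (j ℕ.* j)) (λ i → q^-below-𝟘 _ (suc R) (≤-square R i)))
                 (sumˢ-extend-below R d (suc R) (λ i → q^ (suc i ℕ.* suc i)) (λ i → q^-below-𝟘 _ (suc R) (≤-square R i))))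
  where
  d : ℕ
  d = R′ ∸ R
  ≤-square : ∀ R i → suc R ≤ suc (R ℕ.+ i) ℕ.* suc (R ℕ.+ i)
  ≤-square R i = ℕₚ.≤-trans (s≤s (ℕₚ.m≤m+n R i)) (ℕₚ.m≤m*n (suc (R ℕ.+ i)) (suc (R ℕ.+ i)))

-- The coefficient identity

Σ[1…]-suc : ∀ n h → Σ[1… suc n ] h ≡ h 1 + Σ[1… n ] (h ∘ suc)
Σ[1…]-suc zero    h = trans (ℤₚ.+-identityˡ (h 1)) (sym (ℤₚ.+-identityʳ (h 1)))
Σ[1…]-suc (suc n) h = trans (cong (_+ h (suc (suc n))) (Σ[1…]-suc n h)) (ℤₚ.+-assoc (h 1) _ _)

Σ[1…]-cong : ∀ n {f g} → f ≗ g → Σ[1… n ] f ≡ Σ[1… n ] g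
Σ[1…]-cong zero    f≗g = refl
Σ[1…]-cong (suc n) f≗g = cong₂ _+_ (Σ[1…]-cong n f≗g) (f≗g (suc n))

*ˢ-coeff : ∀ f g n → (f *ˢ g) n ≡ f 0 * g n + Σ[1… n ] (λ i → f i * g (n ∸ i))
*ˢ-coeff f g zero    = sym (ℤₚ.+-identityʳ _)
*ˢ-coeff f g (suc n) = cong (_+_ (f 0 * g (suc n)))
  (trans (*ˢ-coeff (tail f) g n) (sym (Σ[1…]-suc n (λ i → f i * g (suc n ∸ i)))))

θ-power-coeff : ∀ k n j → j ≤ n → (alt (thetaUpTo n) ^ˢ k) j ≡ sgn j * + r k j
θ-power-coeff k n j j≤n = begin
  (alt (thetaUpTo n) ^ˢ k) j   ≡⟨ alt-^ˢ (thetaUpTo n) k j ⟨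
  sgn j * (thetaUpTo n ^ˢ k) j ≡⟨ cong (sgn j *_) (^ˢ-cong-below k (thetaUpTo-stable j n j≤n) j ℕₚ.≤-refl) ⟩
  sgn j * (thetaUpTo j ^ˢ k) j ≡⟨ cong (sgn j *_) (^ˢ-cong-below k (≗⇒≈[] (squaresSeries-range j)) j ℕₚ.≤-refl) ⟨
  sgn j * (squaresSeries (range j) ^ˢ k) j ≡⟨ cong (sgn j *_) (r-coeff k j) ⟨
  sgn j * + r k j              ∎
  where open ≡-Reasoning

jacobi-alt-below : ∀ m → q-q²-poch (suc m) *ˢ q-q²-poch (suc m) *ˢ q²-poch (suc m)
                         ≈[ suc (suc m ℕ.+ suc m) ] alt (thetaUpTo (suc m))
jacobi-alt-below m = ≈[]-trans (TripleProduct.jacobi-below m) (≗⇒≈[] (signedTheta-alt (suc m)))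

D-θ-power-below : ∀ k m → D (alt (thetaUpTo (suc m)) ^ˢ k)
                  ≈[ suc (suc m ℕ.+ suc m) ] -ˢ (+ k · σ+σₒ *ˢ alt (thetaUpTo (suc m)) ^ˢ k)
D-θ-power-below k m = NegLogDeriv-below (^ˢ-cong-below k (jacobi-alt-below m))
  (λ i i<K → cong (+ k *_) (lambertSum-below (suc m) i i<K)) (NegLogDeriv-^ˢ k (NegLogDeriv-Jacobi (suc m)))

mainTheorem19 : (k : ℕ) → k ≥ 2 → (n : ℕ) → n ≥ 1 →
    + k * (Σ[1… n ] (λ i → (+ (σ i) + + (σₒ i)) * sgn (n ∸ i) * + (r k (n ∸ i))))
      ≡ sgn (n Data.Nat.+ 1) * + n * + (r k n)
mainTheorem19 k _ (suc m) _ = begin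
  + k * Σ[1… n ] (λ i → σ+σₒ i * sgn (n ∸ i) * + r k (n ∸ i))
    ≡⟨ cong (+ k *_) (Σ[1…]-cong n (λ i → trans (ℤₚ.*-assoc (σ+σₒ i) _ _)
                                           (cong (σ+σₒ i *_) (sym (θ-power-coeff k n (n ∸ i) (ℕₚ.m∸n≤m n i)))))) ⟩
  + k * Σ[1… n ] (λ i → σ+σₒ i * Θᵏ (n ∸ i))
    ≡⟨ cong (+ k *_) (trans (sym (ℤₚ.+-identityˡ _)) (sym (*ˢ-coeff σ+σₒ Θᵏ n))) ⟩
  + k * (σ+σₒ *ˢ Θᵏ) n
    ≡⟨ ·-*ˢ-assoc (+ k) σ+σₒ Θᵏ n ⟨
  (+ k · σ+σₒ *ˢ Θᵏ) n
    ≡⟨ ℤₚ.neg-involutive _ ⟨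
  - (- (+ k · σ+σₒ *ˢ Θᵏ) n)
    ≡⟨ cong -_ (D-θ-power-below k m n (s≤s (ℕₚ.m≤m+n n n))) ⟨
  - (+ n * Θᵏ n)
    ≡⟨ cong (λ z → - (+ n * z)) (θ-power-coeff k n n ℕₚ.≤-refl) ⟩
  - (+ n * (sgn n * + r k n))
    ≡⟨ sign-shuffle (sgn n) (+ n) (+ r k n) ⟩
  - sgn n * + n * + r k n
    ≡⟨ cong (λ j → sgn j * + n * + r k n) (ℕₚ.+-comm 1 n) ⟩
  sgn (n ℕ.+ 1) * + n * + r k n ∎
  where
  open ≡-Reasoning
  n : ℕ
  n = suc m
  Θᵏ : Series
  Θᵏ = alt (thetaUpTo n) ^ˢ k
  sign-shuffle : ∀ s a b → - (a * (s * b)) ≡ - s * a * b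
  sign-shuffle = solve-∀
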